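{- Let $r\ge2$, $k\ge2$, $n=2k-1$ and $m_1=\cdots=m_r=1$. Let $D$ be the distance matrix of the graph $C(n;m_1,\dots,m_r)$. Then $$\det D=(-2)^{r-1}\big[k(k+1)-(r-1)(3k^2-k-2)\big].$$
   Context: $C(n;m_1,\dots,m_r)$ is the undirected, unweighted graph consisting of a path $u_0-u_1-\cdots-u_n$ of length $n$ together with, for each $1\le j\le r$, a path $u_n-v_1^{(j)}-\cdots-v_{m_j}^{(j)}-u_0$ through $m_j$ new vertices; thus it consists of $r$ cycles of lengths $n+m_1+1,\dots,n+m_r+1$, any two of which intersect exactly in the common path. Its distance matrix is $[d(x,y)]$ with $d$ the usual shortest-path distance. -}

module Defs where

open import Data.Nat as ℕ using (ℕ; zero; suc; _≤_)
open import Data.Fin using (Fin; zero; suc; toℕ; fromℕ; inject₁; punchIn)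
open import Data.Integer as ℤ using (ℤ; +_; -_)
open import Data.Sum using (_⊎_)
open import Relation.Binary.PropositionalEquality using (_≡_)

-- The graph C(n; m_1, ..., m_r)
--   vertices: u_0 .. u_n  (u i, i : Fin (suc n))
--             v^{(j)}_1 .. v^{(j)}_{m_j}  (v j p, p : Fin (m j), p = 0-based,
--             i.e. v j p is v^{(j)}_{p+1})

data Vertex (n r : ℕ) (m : Fin r → ℕ) : Set where
  u : Fin (suc n) → Vertex n r m
  v : (j : Fin r) → Fin (m j) → Vertex n r m

data Edge (n r : ℕ) (m : Fin r → ℕ) : Vertex n r m → Vertex n r m → Set where
  path  : (a : Fin n) → Edge n r m (u (inject₁ a)) (u (suc a))
  first : (j : Fin r) (p : Fin (m j)) → toℕ p ≡ 0 →
          Edge n r m (u (fromℕ n)) (v j p)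
  inner : (j : Fin r) (a b : Fin (m j)) → toℕ b ≡ suc (toℕ a) →
          Edge n r m (v j a) (v j b)
  last  : (j : Fin r) (p : Fin (m j)) → suc (toℕ p) ≡ m j →
          Edge n r m (v j p) (u zero)
  -- if m_j = 0 the j-th path u_n - u_0 is a single edge
  chord : (j : Fin r) → m j ≡ 0 → Edge n r m (u (fromℕ n)) (u zero)

Adj : ∀ {n r m} → Vertex n r m → Vertex n r m → Set
Adj {n} {r} {m} x y = Edge n r m x y ⊎ Edge n r m y x

data Walk {n r : ℕ} {m : Fin r → ℕ} :
     Vertex n r m → Vertex n r m → ℕ → Set where
  stay : ∀ x → Walk x x 0
  step : ∀ {x y z ℓ} → Adj x y → Walk y z ℓ → Walk x z (suc ℓ)

IsDistance : ∀ {n r m} → Vertex n r m → Vertex n r m → ℕ → Set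
IsDistance x y d = Walk x y d × (∀ ℓ → Walk x y ℓ → d ≤ ℓ)
  where open import Data.Product using (_×_)

sumFin : ∀ {k} → (Fin k → ℤ) → ℤ
sumFin {zero}  f = + 0
sumFin {suc k} f = f zero ℤ.+ sumFin (λ i → f (suc i))

sign : ℕ → ℤ
sign zero    = + 1
sign (suc k) = - sign k

det : ∀ {k} → (Fin k → Fin k → ℤ) → ℤ
det {zero}  A = + 1
det {suc k} A =
  sumFin (λ j → sign (toℕ j) ℤ.* A zero j ℤ.*
                det (λ i′ j′ → A (suc i′) (punchIn j j′)))

-- Put the hubs v⁽¹⁾, …, v⁽ʳ⁾ first and label the cycle v, u₀, …, uₙ of length 2k + 1 by 0, 2, …, 2k, 1, 3, …,
-- 2k − 1. Then two non-hub vertices, or a hub and a non-hub vertex, are at distance ψ(|ℓ − ℓ′|) with ψ(2i) = i and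
-- ψ(2i + 1) = k − i, while distinct hubs are at distance 2: the distance matrix is the Toeplitz matrix
-- Ψ_{2k} = [ψ(|i − j|)] bordered by r identical hub rows and columns. Subtracting hub rows and columns
-- gives det D = (−2)^{r−1} (det Ψ_{2k+1} + (r − 1)(det Ψ_{2k+1} + 2 det Ψ_{2k})).
-- The Toeplitz determinants are computed with ψ(1) = t kept symbolic. The four rows R_i + R_{i+1} − R_{i+2} −
-- R_{i+3} of [ψ(|i − j|)] combine to −e_{i+1} + e_{i+2}; replacing the first row by this combination and
-- expanding lowers the order by one while merging two columns, down to an explicit 3 × 3 determinant. At t = k
-- this gives det Ψ_{2k+1} = k(k + 1) and det Ψ_{2k} = 1 − 2k², and the formula follows.

module Submission where

open import Defs
open import Data.Nat as ℕ using (ℕ; zero; suc; ∣_-_∣; z≤n; s≤s; _∸_; _<_; _≤_)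
import Data.Nat.Properties as ℕP
import Data.Nat.Tactic.RingSolver as ℕS
open import Data.Fin as F using (Fin; zero; suc; toℕ; punchIn; punchOut; inject₁; fromℕ; cast)
open import Data.Fin.Patterns using (0F; 1F; 2F; 3F)
open import Data.Fin.Properties
  using (punchIn-punchOut; punchOut-punchIn; punchOut-cong; punchInᵢ≢i; punchIn-injective; punchOut-injective; suc-injective)
import Data.Fin.Properties as FP
import Data.Fin.Permutation.Components as PC
open import Data.Integer as ℤ using (ℤ; +_; -_; _+_; _-_; _*_; _^_; -1ℤ; -[1+_]; +≤+)
import Data.Integer.Properties as ℤP
open ℤP using (+-identityʳ; +-identityˡ; *-identityˡ; *-zeroʳ; *-zeroˡ; -1*i≡-i; neg-involutive)
open import Data.Integer.Tactic.RingSolver using (solve-∀)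
open import Algebra.Properties.CommutativeMonoid.Sum ℤP.+-0-commutativeMonoid
  using (sum; sum-cong-≗; sum-replicate-zero; sum-remove; ∑-distrib-+; ∑-comm)
open import Algebra.Properties.Semiring.Sum ℤP.+-*-semiring using (*-distribˡ-sum)
open import Data.Product using (_×_; _,_; proj₁; proj₂; Σ-syntax)
open import Data.Sum using (_⊎_; inj₁; inj₂)
open import Data.Empty using (⊥-elim)
open import Function using (_∘_)
open import Function.Bundles using (_↔_; Inverse)
open import Relation.Nullary using (yes; no; ¬_; Dec)
open import Relation.Binary.Definitions using (tri<; tri≈; tri>)
open import Relation.Binary.PropositionalEquality

cong₃ : ∀ {A B C D : Set} (f : A → B → C → D) {x x′ y y′ z z′} →
        x ≡ x′ → y ≡ y′ → z ≡ z′ → f x y z ≡ f x′ y′ z′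
cong₃ f refl refl refl = refl

Matrix : ℕ → Set
Matrix k = Fin k → Fin k → ℤ

sumFin≡sum : ∀ {k} (f : Fin k → ℤ) → sumFin f ≡ sum f
sumFin≡sum {zero}  f = refl
sumFin≡sum {suc k} f = cong (λ s → f zero + s) (sumFin≡sum (f ∘ suc))

sumFin-cong : ∀ {k} {f g : Fin k → ℤ} → (∀ i → f i ≡ g i) → sumFin f ≡ sumFin g
sumFin-cong {f = f} {g} f≗g =
  trans (sumFin≡sum f) (trans (sum-cong-≗ f≗g) (sym (sumFin≡sum g)))

sumFin-zero : ∀ {k} (f : Fin k → ℤ) → (∀ i → f i ≡ + 0) → sumFin f ≡ + 0
sumFin-zero {k} f f≗0 = trans (sumFin≡sum f) (trans (sum-cong-≗ f≗0) (sum-replicate-zero k))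

sumFin-distrib-+ : ∀ {k} (f g : Fin k → ℤ) → sumFin (λ i → f i + g i) ≡ sumFin f + sumFin g
sumFin-distrib-+ f g
  rewrite sumFin≡sum (λ i → f i + g i) | sumFin≡sum f | sumFin≡sum g = ∑-distrib-+ f g

*-distribˡ-sumFin : ∀ {k} (c : ℤ) (f : Fin k → ℤ) → c * sumFin f ≡ sumFin (λ i → c * f i)
*-distribˡ-sumFin c f
  rewrite sumFin≡sum f | sumFin≡sum (λ i → c * f i) = *-distribˡ-sum c f

sumFin-linear : ∀ {k} (c : ℤ) (f g : Fin k → ℤ) →
                sumFin (λ i → f i + c * g i) ≡ sumFin f + c * sumFin g
sumFin-linear c f g =
  trans (sumFin-distrib-+ f (λ i → c * g i)) (cong (λ s → sumFin f + s) (sym (*-distribˡ-sumFin c g)))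

sumFin-neg : ∀ {k} (f : Fin k → ℤ) → sumFin (λ i → - f i) ≡ - sumFin f
sumFin-neg f = begin
  sumFin (λ i → - f i)     ≡⟨ sumFin-cong (λ i → sym (-1*i≡-i (f i))) ⟩
  sumFin (λ i → -1ℤ * f i) ≡⟨ sym (*-distribˡ-sumFin -1ℤ f) ⟩
  -1ℤ * sumFin f           ≡⟨ -1*i≡-i _ ⟩
  - sumFin f               ∎
  where open ≡-Reasoning

sumFin-comm : ∀ {k l} (f : Fin k → Fin l → ℤ) →
              sumFin (λ a → sumFin (f a)) ≡ sumFin (λ b → sumFin (λ a → f a b))
sumFin-comm f = begin
  sumFin (λ a → sumFin (f a))              ≡⟨ sumFin-cong (λ a → sumFin≡sum (f a)) ⟩
  sumFin (λ a → sum (f a))                 ≡⟨ sumFin≡sum (λ a → sum (f a)) ⟩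
  sum (λ a → sum (f a))                    ≡⟨ ∑-comm f ⟩
  sum (λ b → sum (λ a → f a b))            ≡⟨ sym (sumFin≡sum (λ b → sum (λ a → f a b))) ⟩
  sumFin (λ b → sum (λ a → f a b))         ≡⟨ sumFin-cong (λ b → sym (sumFin≡sum (λ a → f a b))) ⟩
  sumFin (λ b → sumFin (λ a → f a b))      ∎
  where open ≡-Reasoning

sumFin-punchIn : ∀ {k} (a : Fin (suc k)) (f : Fin (suc k) → ℤ) →
                 sumFin f ≡ f a + sumFin (f ∘ punchIn a)
sumFin-punchIn a f
  rewrite sumFin≡sum f | sumFin≡sum (f ∘ punchIn a) = sum-remove {i = a} f

minor : ∀ {k} → Matrix (suc k) → Fin (suc k) → Matrix k
minor A j i l = A (suc i) (punchIn j l)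

laplaceTerm : ∀ {k} → Matrix (suc k) → Fin (suc k) → ℤ
laplaceTerm A j = sign (toℕ j) * A zero j * det (minor A j)

det-cong : ∀ {k} {A B : Matrix k} → (∀ i j → A i j ≡ B i j) → det A ≡ det B
det-cong {zero}  A≗B = refl
det-cong {suc k} A≗B = sumFin-cong λ j →
  cong₂ (λ x d → sign (toℕ j) * x * d) (A≗B zero j) (det-cong (λ i l → A≗B (suc i) (punchIn j l)))

laplaceTerm-linear-entry : ∀ {k} (c : ℤ) (A B C : Matrix (suc k)) j →
  C zero j ≡ A zero j + c * B zero j → det (minor C j) ≡ det (minor A j) → det (minor B j) ≡ det (minor A j) →
  laplaceTerm C j ≡ laplaceTerm A j + c * laplaceTerm B j
laplaceTerm-linear-entry c A B C j C₀ⱼ Cᵢ Bᵢ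
  rewrite C₀ⱼ | Cᵢ | Bᵢ = distrib c (sign (toℕ j)) (A zero j) (B zero j) (det (minor A j))
  where distrib : ∀ c s a b d → s * (a + c * b) * d ≡ s * a * d + c * (s * b * d)
        distrib = solve-∀

laplaceTerm-linear-minor : ∀ {k} (c : ℤ) (A B C : Matrix (suc k)) j →
  C zero j ≡ A zero j → B zero j ≡ A zero j → det (minor C j) ≡ det (minor A j) + c * det (minor B j) →
  laplaceTerm C j ≡ laplaceTerm A j + c * laplaceTerm B j
laplaceTerm-linear-minor c A B C j C₀ⱼ B₀ⱼ Cᵢ
  rewrite C₀ⱼ | B₀ⱼ | Cᵢ = distrib c (sign (toℕ j)) (A zero j) (det (minor A j)) (det (minor B j))
  where distrib : ∀ c s a d e → s * a * (d + c * e) ≡ s * a * d + c * (s * a * e)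
        distrib = solve-∀

det-linear-laplace : ∀ {k} (c : ℤ) (A B C : Matrix (suc k)) →
  (∀ j → laplaceTerm C j ≡ laplaceTerm A j + c * laplaceTerm B j) →
  det C ≡ det A + c * det B
det-linear-laplace c A B C terms =
  trans (sumFin-cong terms) (sumFin-linear c (laplaceTerm A) (laplaceTerm B))

det-linear-row : ∀ {k} (r : Fin k) (c : ℤ) (A B C : Matrix k) →
  (∀ j → C r j ≡ A r j + c * B r j) →
  (∀ i j → i ≢ r → C i j ≡ A i j) → (∀ i j → i ≢ r → B i j ≡ A i j) →
  det C ≡ det A + c * det B
det-linear-row zero c A B C Cᵣ C≡A B≡A = det-linear-laplace c A B C λ j →
  laplaceTerm-linear-entry c A B C j (Cᵣ j) (same-minor C≡A j) (same-minor B≡A j)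
  where same-minor : ∀ {M} → (∀ i j → i ≢ zero → M i j ≡ A i j) → ∀ j → det (minor M j) ≡ det (minor A j)
        same-minor M≡A j = det-cong (λ i l → M≡A (suc i) (punchIn j l) λ ())
det-linear-row (suc r) c A B C Cᵣ C≡A B≡A = det-linear-laplace c A B C λ j →
  laplaceTerm-linear-minor c A B C j (C≡A zero j λ ()) (B≡A zero j λ ())
    (det-linear-row r c (minor A j) (minor B j) (minor C j) (λ l → Cᵣ (punchIn j l))
       (λ i l i≢r → C≡A (suc i) (punchIn j l) (i≢r ∘ suc-injective))
       (λ i l i≢r → B≡A (suc i) (punchIn j l) (i≢r ∘ suc-injective)))

det-linear-col : ∀ {k} (r : Fin k) (c : ℤ) (A B C : Matrix k) →
  (∀ i → C i r ≡ A i r + c * B i r) →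
  (∀ i j → j ≢ r → C i j ≡ A i j) → (∀ i j → j ≢ r → B i j ≡ A i j) →
  det C ≡ det A + c * det B
det-linear-col {suc k} r c A B C Cᵣ C≡A B≡A = det-linear-laplace c A B C term
  where
  term : ∀ j → laplaceTerm C j ≡ laplaceTerm A j + c * laplaceTerm B j
  term j with j F.≟ r
  ... | yes refl = laplaceTerm-linear-entry c A B C j (Cᵣ zero) (same-minor C≡A) (same-minor B≡A)
    where same-minor : ∀ {M} → (∀ i l → l ≢ j → M i l ≡ A i l) → det (minor M j) ≡ det (minor A j)
          same-minor M≡A = det-cong (λ i l → M≡A (suc i) (punchIn j l) (punchInᵢ≢i j l))
  ... | no j≢r = laplaceTerm-linear-minor c A B C j (C≡A zero j j≢r) (B≡A zero j j≢r)
                   (det-linear-col r′ c (minor A j) (minor B j) (minor C j) colᵣ (other C≡A) (other B≡A))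
    where
    r′ = punchOut j≢r
    other : ∀ {M} → (∀ i l → l ≢ r → M i l ≡ A i l) → ∀ i l → l ≢ r′ → minor M j i l ≡ minor A j i l
    other M≡A i l l≢r′ = M≡A (suc i) (punchIn j l)
      λ eq → l≢r′ (punchIn-injective j l r′ (trans eq (sym (punchIn-punchOut j≢r))))
    colᵣ : ∀ i → minor C j i r′ ≡ minor A j i r′ + c * minor B j i r′
    colᵣ i rewrite punchIn-punchOut j≢r = Cᵣ (suc i)

punchIn-punchOut-comm : ∀ {n} (a b : Fin (suc (suc n))) (a≢b : a ≢ b) (b≢a : b ≢ a) (j : Fin n) →
  punchIn a (punchIn (punchOut a≢b) j) ≡ punchIn b (punchIn (punchOut b≢a) j)
punchIn-punchOut-comm zero    zero    a≢b _ j = ⊥-elim (a≢b refl)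
punchIn-punchOut-comm zero    (suc b) _   _ j = refl
punchIn-punchOut-comm (suc a) zero    _   _ j = refl
punchIn-punchOut-comm (suc a) (suc b) _   _ zero = refl
punchIn-punchOut-comm {suc n} (suc a) (suc b) a≢b b≢a (suc j) =
  cong suc (punchIn-punchOut-comm a b (a≢b ∘ cong suc) (b≢a ∘ cong suc) j)

sign-punchOut-swap : ∀ {m} (a b : Fin (suc m)) (a≢b : a ≢ b) (b≢a : b ≢ a) →
  sign (toℕ b) * sign (toℕ (punchOut b≢a)) ≡ - (sign (toℕ a) * sign (toℕ (punchOut a≢b)))
sign-punchOut-swap zero zero a≢b _ = ⊥-elim (a≢b refl)
sign-punchOut-swap {suc m} zero (suc b) _ _ = lemma (sign (toℕ b))
  where lemma : ∀ x → - x * + 1 ≡ - (+ 1 * x)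
        lemma = solve-∀
sign-punchOut-swap {suc m} (suc a) zero _ _ = lemma (sign (toℕ a))
  where lemma : ∀ x → + 1 * x ≡ - (- x * + 1)
        lemma = solve-∀
sign-punchOut-swap {suc m} (suc a) (suc b) a≢b b≢a =
  trans (neg-cancel (sign (toℕ b)) (sign (toℕ (punchOut (b≢a ∘ cong suc)))))
    (trans (sign-punchOut-swap a b (a≢b ∘ cong suc) (b≢a ∘ cong suc))
      (cong -_ (sym (neg-cancel (sign (toℕ a)) (sign (toℕ (punchOut (a≢b ∘ cong suc))))))))
  where neg-cancel : ∀ x y → - x * - y ≡ x * y
        neg-cancel = solve-∀

x≡-x⇒x≡0 : ∀ (x : ℤ) → x ≡ - x → x ≡ + 0
x≡-x⇒x≡0 (+ zero)   _ = refl
x≡-x⇒x≡0 ℤ.+[1+ n ] ()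
x≡-x⇒x≡0 ℤ.-[1+ n ] ()

-- Expanding along rows 0 and 1 writes det A as a sum over pairs of distinct columns (a, b) used by these
-- rows; when the two rows agree, the terms of (a, b) and (b, a) cancel.
module _ {k : ℕ} (A : Matrix (suc (suc k))) (rows≡ : ∀ j → A zero j ≡ A (suc zero) j) where
  private
    open ≡-Reasoning

    term : Fin (suc (suc k)) → Fin (suc k) → ℤ
    term a l = sign (toℕ a) * sign (toℕ l) * (A zero a * A (suc zero) (punchIn a l))
               * det (minor (minor A a) l)

    det≡double-sum : det A ≡ sumFin (λ a → sumFin (term a))
    det≡double-sum = sumFin-cong λ a → begin
      sign (toℕ a) * A zero a * sumFin (laplaceTerm (minor A a))
        ≡⟨ *-distribˡ-sumFin (sign (toℕ a) * A zero a) (laplaceTerm (minor A a)) ⟩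
      sumFin (λ l → sign (toℕ a) * A zero a * laplaceTerm (minor A a) l)
        ≡⟨ sumFin-cong (λ l → regroup (sign (toℕ a)) (A zero a) (sign (toℕ l))
                                      (A (suc zero) (punchIn a l)) (det (minor (minor A a) l))) ⟩
      sumFin (term a) ∎
      where regroup : ∀ s x t y d → s * x * (t * y * d) ≡ s * t * (x * y) * d
            regroup = solve-∀

    pairTerm : Fin (suc (suc k)) → Fin (suc (suc k)) → ℤ
    pairTerm a b with a F.≟ b
    ... | yes _   = + 0
    ... | no a≢b = term a (punchOut a≢b)

    pairTerm-diag : ∀ a → pairTerm a a ≡ + 0
    pairTerm-diag a with a F.≟ a
    ... | yes _   = refl
    ... | no a≢a = ⊥-elim (a≢a refl)

    pairTerm-off : ∀ a b (a≢b : a ≢ b) → pairTerm a b ≡ term a (punchOut a≢b)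
    pairTerm-off a b a≢b with a F.≟ b
    ... | yes a≡b = ⊥-elim (a≢b a≡b)
    ... | no _     = cong (term a) (punchOut-cong a refl)

    row-sum : ∀ a → sumFin (term a) ≡ sumFin (pairTerm a)
    row-sum a = sym (begin
      sumFin (pairTerm a)
        ≡⟨ sumFin-punchIn a (pairTerm a) ⟩
      pairTerm a a + sumFin (pairTerm a ∘ punchIn a)
        ≡⟨ cong₂ _+_ (pairTerm-diag a) (sumFin-cong λ l →
             trans (pairTerm-off a (punchIn a l) (punchInᵢ≢i a l ∘ sym)) (cong (term a) (punchOut-punchIn a))) ⟩
      + 0 + sumFin (term a)
        ≡⟨ +-identityˡ _ ⟩
      sumFin (term a) ∎)

    pairTerm-antisym : ∀ a b → pairTerm b a ≡ - pairTerm a b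
    pairTerm-antisym a b with a F.≟ b
    ... | yes refl = pairTerm-diag a
    ... | no a≢b = begin
      pairTerm b a
        ≡⟨ pairTerm-off b a b≢a ⟩
      s b b≢a * (A zero b * A (suc zero) (punchIn b (punchOut b≢a))) * det (minor (minor A b) (punchOut b≢a))
        ≡⟨ cong₃ (λ s x d → s * x * d) (sign-punchOut-swap a b a≢b b≢a)
                 (cong (λ x → A zero b * A (suc zero) x) (punchIn-punchOut b≢a))
                 (det-cong λ i j → cong (A (suc (suc i))) (sym (punchIn-punchOut-comm a b a≢b b≢a j))) ⟩
      - s a a≢b * (A zero b * A (suc zero) a) * det (minor (minor A a) (punchOut a≢b))
        ≡⟨ cong (λ x → - s a a≢b * x * det (minor (minor A a) (punchOut a≢b))) swap-entries ⟩
      - s a a≢b * (A zero a * A (suc zero) (punchIn a (punchOut a≢b))) * det (minor (minor A a) (punchOut a≢b))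
        ≡⟨ neg-first (s a a≢b) _ _ ⟩
      - term a (punchOut a≢b) ∎
      where
      b≢a : b ≢ a
      b≢a = a≢b ∘ sym
      s : ∀ x {y} → x ≢ y → ℤ
      s x x≢y = sign (toℕ x) * sign (toℕ (punchOut x≢y))
      swap-entries : A zero b * A (suc zero) a ≡ A zero a * A (suc zero) (punchIn a (punchOut a≢b))
      swap-entries rewrite punchIn-punchOut a≢b | rows≡ a | rows≡ b = ℤP.*-comm (A (suc zero) b) (A (suc zero) a)
      neg-first : ∀ s x d → - s * x * d ≡ - (s * x * d)
      neg-first = solve-∀

  det-equal-rows₀₁ : det A ≡ + 0
  det-equal-rows₀₁ = begin
    det A                                       ≡⟨ det≡double-sum ⟩
    sumFin (λ a → sumFin (term a))              ≡⟨ sumFin-cong row-sum ⟩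
    sumFin (λ a → sumFin (pairTerm a))          ≡⟨ x≡-x⇒x≡0 _ antisym ⟩
    + 0                                         ∎
    where
    antisym : sumFin (λ a → sumFin (pairTerm a)) ≡ - sumFin (λ a → sumFin (pairTerm a))
    antisym = begin
      sumFin (λ a → sumFin (pairTerm a))        ≡⟨ sumFin-comm pairTerm ⟩
      sumFin (λ b → sumFin (λ a → pairTerm a b))
        ≡⟨ sumFin-cong (λ b → trans (sumFin-cong (pairTerm-antisym b)) (sumFin-neg (pairTerm b))) ⟩
      sumFin (λ b → - sumFin (pairTerm b))       ≡⟨ sumFin-neg (λ b → sumFin (pairTerm b)) ⟩
      - sumFin (λ a → sumFin (pairTerm a))       ∎

det-additive-row : ∀ {k} (r : Fin k) (A B C : Matrix k) →
  (∀ j → C r j ≡ A r j + B r j) →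
  (∀ i j → i ≢ r → C i j ≡ A i j) → (∀ i j → i ≢ r → B i j ≡ A i j) →
  det C ≡ det A + det B
det-additive-row r A B C Cᵣ C≡A B≡A =
  trans (det-linear-row r (+ 1) A B C (λ j → trans (Cᵣ j) (cong (λ x → A r j + x) (sym (*-identityˡ (B r j)))))
                        C≡A B≡A)
        (cong (λ x → det A + x) (*-identityˡ (det B)))

det-additive-col : ∀ {k} (r : Fin k) (A B C : Matrix k) →
  (∀ i → C i r ≡ A i r + B i r) →
  (∀ i j → j ≢ r → C i j ≡ A i j) → (∀ i j → j ≢ r → B i j ≡ A i j) →
  det C ≡ det A + det B
det-additive-col r A B C Cᵣ C≡A B≡A =
  trans (det-linear-col r (+ 1) A B C (λ i → trans (Cᵣ i) (cong (λ x → A i r + x) (sym (*-identityˡ (B i r)))))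
                        C≡A B≡A)
        (cong (λ x → det A + x) (*-identityˡ (det B)))

adjacentSwap : ∀ {n} → Fin n → Fin (suc n) → Fin (suc n)
adjacentSwap zero    zero          = suc zero
adjacentSwap zero    (suc zero)    = zero
adjacentSwap zero    (suc (suc x)) = suc (suc x)
adjacentSwap (suc p) zero          = zero
adjacentSwap (suc p) (suc x)       = suc (adjacentSwap p x)

adjacentSwap-involutive : ∀ {n} (p : Fin n) x → adjacentSwap p (adjacentSwap p x) ≡ x
adjacentSwap-involutive zero    zero          = refl
adjacentSwap-involutive zero    (suc zero)    = refl
adjacentSwap-involutive zero    (suc (suc x)) = refl
adjacentSwap-involutive (suc p) zero          = refl
adjacentSwap-involutive (suc p) (suc x)       = cong suc (adjacentSwap-involutive p x)

sumFin-adjacentSwap : ∀ {n} (p : Fin n) (f : Fin (suc n) → ℤ) → sumFin (f ∘ adjacentSwap p) ≡ sumFin f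
sumFin-adjacentSwap zero f = exchange (f (suc zero)) (f zero) _
  where exchange : ∀ x y z → x + (y + z) ≡ y + (x + z)
        exchange = solve-∀
sumFin-adjacentSwap (suc p) f = cong (λ x → f zero + x) (sumFin-adjacentSwap p (f ∘ suc))

module _ {k : ℕ} (A : Matrix (suc (suc k))) where
  private
    Row = Fin (suc (suc k)) → ℤ

    withTopRows : Row → Row → Matrix (suc (suc k))
    withTopRows q r zero          = q
    withTopRows q r (suc zero)    = r
    withTopRows q r (suc (suc i)) = A (suc (suc i))

    T : Row → Row → ℤ
    T q r = det (withTopRows q r)

    T-diag : ∀ q → T q q ≡ + 0
    T-diag q = det-equal-rows₀₁ (withTopRows q q) (λ _ → refl)

    T-additiveˡ : ∀ q q′ r → T (λ j → q j + q′ j) r ≡ T q r + T q′ r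
    T-additiveˡ q q′ r =
      det-additive-row zero (withTopRows q r) (withTopRows q′ r) (withTopRows (λ j → q j + q′ j) r)
                       (λ _ → refl) other other
      where other : ∀ {q q′} i j → i ≢ zero → withTopRows q r i j ≡ withTopRows q′ r i j
            other zero          j 0≢0 = ⊥-elim (0≢0 refl)
            other (suc zero)    j _   = refl
            other (suc (suc i)) j _   = refl

    T-additiveʳ : ∀ q r r′ → T q (λ j → r j + r′ j) ≡ T q r + T q r′
    T-additiveʳ q r r′ =
      det-additive-row (suc zero) (withTopRows q r) (withTopRows q r′) (withTopRows q (λ j → r j + r′ j))
                       (λ _ → refl) other other
      where other : ∀ {r r′} i j → i ≢ suc zero → withTopRows q r i j ≡ withTopRows q r′ i j
            other zero          j _   = refl
            other (suc zero)    j 1≢1 = ⊥-elim (1≢1 refl)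
            other (suc (suc i)) j _   = refl

    T-antisym : ∀ q r → T q r ≡ - T r q
    T-antisym q r = cancel (T q q) (T q r) (T r q) (T r r) (T-diag q) (T-diag r) (begin
      + 0                                       ≡⟨ sym (T-diag (λ j → q j + r j)) ⟩
      T (λ j → q j + r j) (λ j → q j + r j)     ≡⟨ T-additiveˡ q r (λ j → q j + r j) ⟩
      T q (λ j → q j + r j) + T r (λ j → q j + r j) ≡⟨ cong₂ _+_ (T-additiveʳ q q r) (T-additiveʳ r q r) ⟩
      (T q q + T q r) + (T r q + T r r)         ∎)
      where
      open ≡-Reasoning
      cancel : ∀ a b c d → a ≡ + 0 → d ≡ + 0 → + 0 ≡ (a + b) + (c + d) → b ≡ - c
      cancel a b c d refl refl total = begin
        b                                   ≡⟨ regroup b c ⟩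
        ((+ 0 + b) + (c + + 0)) + - c       ≡⟨ cong (λ x → x + - c) (sym total) ⟩
        + 0 + - c                           ≡⟨ +-identityˡ (- c) ⟩
        - c                                 ∎
        where regroup : ∀ b c → b ≡ ((+ 0 + b) + (c + + 0)) + - c
              regroup = solve-∀

  det-swap-rows₀₁ : det (λ x y → A (adjacentSwap zero x) y) ≡ - det A
  det-swap-rows₀₁ = begin
    det (λ x y → A (adjacentSwap zero x) y)   ≡⟨ det-cong swapped ⟩
    T (A (suc zero)) (A zero)                 ≡⟨ T-antisym (A (suc zero)) (A zero) ⟩
    - T (A zero) (A (suc zero))               ≡⟨ cong -_ (det-cong unswapped) ⟩
    - det A                                   ∎
    where
    open ≡-Reasoning
    swapped : ∀ i j → A (adjacentSwap zero i) j ≡ withTopRows (A (suc zero)) (A zero) i j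
    swapped zero          j = refl
    swapped (suc zero)    j = refl
    swapped (suc (suc i)) j = refl
    unswapped : ∀ i j → withTopRows (A zero) (A (suc zero)) i j ≡ A i j
    unswapped zero          j = refl
    unswapped (suc zero)    j = refl
    unswapped (suc (suc i)) j = refl

det-swap-rows : ∀ {n} (p : Fin n) (A : Matrix (suc n)) → det (λ x y → A (adjacentSwap p x) y) ≡ - det A
det-swap-rows zero A = det-swap-rows₀₁ A
det-swap-rows {suc n} (suc p) A = trans (sumFin-cong term) (sumFin-neg (laplaceTerm A))
  where
  term : ∀ j → sign (toℕ j) * A zero j * det (λ x y → minor A j (adjacentSwap p x) y) ≡ - laplaceTerm A j
  term j = trans (cong (sign (toℕ j) * A zero j *_) (det-swap-rows p (minor A j)))
                 (sym (ℤP.neg-distribʳ-* (sign (toℕ j) * A zero j) (det (minor A j))))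

data SwapOnColumn {m : ℕ} (p : Fin (suc m)) (j : Fin (suc (suc m))) : Set where
  moved : sign (toℕ (adjacentSwap p j)) ≡ - sign (toℕ j) →
          (∀ l → adjacentSwap p (punchIn (adjacentSwap p j) l) ≡ punchIn j l) → SwapOnColumn p j
  fixed : adjacentSwap p j ≡ j → (q : Fin m) →
          (∀ l → adjacentSwap p (punchIn j l) ≡ punchIn j (adjacentSwap q l)) → SwapOnColumn p j

swapOnColumn : ∀ {m} (p : Fin (suc m)) (j : Fin (suc (suc m))) → SwapOnColumn p j
swapOnColumn zero zero       = moved refl (λ { zero → refl ; (suc l) → refl })
swapOnColumn zero (suc zero) = moved refl (λ { zero → refl ; (suc l) → refl })
swapOnColumn {suc m} zero (suc (suc j)) =
  fixed refl zero (λ { zero → refl ; (suc zero) → refl ; (suc (suc l)) → refl })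
swapOnColumn (suc p) zero = fixed refl p (λ l → refl)
swapOnColumn {suc m} (suc p) (suc j) with swapOnColumn p j
... | moved sign≡ punch≡   = moved (cong -_ sign≡) (λ { zero → refl ; (suc l) → cong suc (punch≡ l) })
... | fixed j≡ q punch≡ = fixed (cong suc j≡) (suc q) (λ { zero → refl ; (suc l) → cong suc (punch≡ l) })

det-swap-cols : ∀ {n} (p : Fin n) (A : Matrix (suc n)) → det (λ x y → A x (adjacentSwap p y)) ≡ - det A
det-swap-cols {suc m} p A = begin
  sumFin (laplaceTerm Aσ)                  ≡⟨ sym (sumFin-adjacentSwap p (laplaceTerm Aσ)) ⟩
  sumFin (laplaceTerm Aσ ∘ σ)              ≡⟨ sumFin-cong term ⟩
  sumFin (λ j → - laplaceTerm A j)         ≡⟨ sumFin-neg (laplaceTerm A) ⟩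
  - det A                                  ∎
  where
  open ≡-Reasoning
  σ = adjacentSwap p
  Aσ : Matrix (suc (suc m))
  Aσ x y = A x (σ y)
  neg-left : ∀ s a d → - s * a * d ≡ - (s * a * d)
  neg-left = solve-∀
  neg-right : ∀ s a d → s * a * - d ≡ - (s * a * d)
  neg-right = solve-∀
  term : ∀ j → laplaceTerm Aσ (σ j) ≡ - laplaceTerm A j
  term j with swapOnColumn p j
  ... | moved sign≡ punch≡ = begin
    sign (toℕ (σ j)) * A zero (σ (σ j)) * det (minor Aσ (σ j))
      ≡⟨ cong₂ (λ s x → s * A zero x * det (minor Aσ (σ j))) sign≡ (adjacentSwap-involutive p j) ⟩
    - sign (toℕ j) * A zero j * det (minor Aσ (σ j))
      ≡⟨ cong (λ d → - sign (toℕ j) * A zero j * d) (det-cong (λ i l → cong (A (suc i)) (punch≡ l))) ⟩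
    - sign (toℕ j) * A zero j * det (minor A j)
      ≡⟨ neg-left (sign (toℕ j)) (A zero j) (det (minor A j)) ⟩
    - laplaceTerm A j ∎
  ... | fixed j≡ q punch≡ = begin
    laplaceTerm Aσ (σ j)
      ≡⟨ cong (laplaceTerm Aσ) j≡ ⟩
    sign (toℕ j) * A zero (σ j) * det (minor Aσ j)
      ≡⟨ cong₂ (λ x d → sign (toℕ j) * A zero x * d) j≡
           (trans (det-cong (λ i l → cong (A (suc i)) (punch≡ l))) (det-swap-cols q (minor A j))) ⟩
    sign (toℕ j) * A zero j * - det (minor A j)
      ≡⟨ neg-right (sign (toℕ j)) (A zero j) (det (minor A j)) ⟩
    - laplaceTerm A j ∎

PreservesDet : ∀ {n} → (Fin n → Fin n) → Set
PreservesDet {n} σ = ∀ (A : Matrix n) → det (λ x y → A (σ x) (σ y)) ≡ det A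

adjacentSwap-preservesDet : ∀ {n} (p : Fin n) → PreservesDet (adjacentSwap p)
adjacentSwap-preservesDet p A = begin
  det (λ x y → A (adjacentSwap p x) (adjacentSwap p y)) ≡⟨ det-swap-rows p (λ x y → A x (adjacentSwap p y)) ⟩
  - det (λ x y → A x (adjacentSwap p y))               ≡⟨ cong -_ (det-swap-cols p A) ⟩
  - - det A                                             ≡⟨ neg-involutive (det A) ⟩
  det A                                                 ∎
  where open ≡-Reasoning

data AdjacentSwaps : ∀ {n} → (Fin n → Fin n) → Set where
  none  : ∀ {n} → AdjacentSwaps {n} (λ x → x)
  _∷_   : ∀ {n} (p : Fin n) {σ} → AdjacentSwaps σ → AdjacentSwaps (adjacentSwap p ∘ σ)
  ext   : ∀ {n} {σ τ : Fin n → Fin n} → (∀ x → σ x ≡ τ x) → AdjacentSwaps τ → AdjacentSwaps σ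

adjacentSwaps-preserveDet : ∀ {n} {σ : Fin n → Fin n} → AdjacentSwaps σ → PreservesDet σ
adjacentSwaps-preserveDet none A = refl
adjacentSwaps-preserveDet (p ∷ σ) A =
  trans (adjacentSwaps-preserveDet σ (λ a b → A (adjacentSwap p a) (adjacentSwap p b)))
        (adjacentSwap-preservesDet p A)
adjacentSwaps-preserveDet (ext σ≗τ τ) A =
  trans (det-cong (λ x y → cong₂ A (σ≗τ x) (σ≗τ y))) (adjacentSwaps-preserveDet τ A)

adjacentSwaps-∘ : ∀ {n} {σ τ : Fin n → Fin n} → AdjacentSwaps σ → AdjacentSwaps τ → AdjacentSwaps (σ ∘ τ)
adjacentSwaps-∘ none        τ = τ
adjacentSwaps-∘ (p ∷ σ)     τ = p ∷ adjacentSwaps-∘ σ τ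
adjacentSwaps-∘ {τ = τ′} (ext σ≗ σ) τ = ext (σ≗ ∘ τ′) (adjacentSwaps-∘ σ τ)

adjacentSwaps-lift : ∀ {n} {σ : Fin n → Fin n} → AdjacentSwaps σ → AdjacentSwaps (F.lift 1 σ)
adjacentSwaps-lift none       = ext (λ { zero → refl ; (suc x) → refl }) none
adjacentSwaps-lift (p ∷ σ)    = ext (λ { zero → refl ; (suc x) → refl }) (suc p ∷ adjacentSwaps-lift σ)
adjacentSwaps-lift (ext σ≗ σ) = ext (λ { zero → refl ; (suc x) → cong suc (σ≗ x) }) (adjacentSwaps-lift σ)

moveZeroTo : ∀ {n} → Fin (suc n) → Fin (suc n) → Fin (suc n)
moveZeroTo a zero    = a
moveZeroTo a (suc l) = punchIn a l

adjacentSwaps-moveZeroTo : ∀ {n} (a : Fin (suc n)) → AdjacentSwaps (moveZeroTo a)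
adjacentSwaps-moveZeroTo zero = ext (λ { zero → refl ; (suc l) → refl }) none
adjacentSwaps-moveZeroTo {suc n} (suc a) =
  ext (λ { zero → refl ; (suc zero) → refl ; (suc (suc l)) → refl })
      (adjacentSwaps-∘ (adjacentSwaps-lift (adjacentSwaps-moveZeroTo a)) (zero ∷ none))

injective⇒adjacentSwaps : ∀ n (σ : Fin n → Fin n) → (∀ x y → σ x ≡ σ y → x ≡ y) → AdjacentSwaps σ
injective⇒adjacentSwaps zero    σ _   = ext (λ ()) none
injective⇒adjacentSwaps (suc n) σ inj =
  ext split (adjacentSwaps-∘ (adjacentSwaps-moveZeroTo (σ zero))
                             (adjacentSwaps-lift (injective⇒adjacentSwaps n σ′ σ′-injective)))
  where
  σ0≢ : ∀ i → σ zero ≢ σ (suc i)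
  σ0≢ i eq with inj _ _ eq
  ... | ()
  σ′ : Fin n → Fin n
  σ′ i = punchOut (σ0≢ i)
  σ′-injective : ∀ x y → σ′ x ≡ σ′ y → x ≡ y
  σ′-injective x y eq = suc-injective (inj _ _ (punchOut-injective (σ0≢ x) (σ0≢ y) eq))
  split : ∀ x → σ x ≡ moveZeroTo (σ zero) (F.lift 1 σ′ x)
  split zero    = refl
  split (suc i) = sym (punchIn-punchOut (σ0≢ i))

det-conj-injective : ∀ {n} (σ : Fin n → Fin n) → (∀ x y → σ x ≡ σ y → x ≡ y) → PreservesDet σ
det-conj-injective σ inj = adjacentSwaps-preserveDet (injective⇒adjacentSwaps _ σ inj)

det-cast : ∀ {m n} (eq : m ≡ n) (B : Matrix n) → det (λ a b → B (F.cast eq a) (F.cast eq b)) ≡ det B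
det-cast refl B = det-cong (λ a b → cong₂ B (FP.cast-is-id refl a) (FP.cast-is-id refl b))

transpose-injective : ∀ {n} (a b : Fin n) x y → PC.transpose a b x ≡ PC.transpose a b y → x ≡ y
transpose-injective a b x y eq =
  trans (sym (PC.transpose-inverse b a)) (trans (cong (PC.transpose b a) eq) (PC.transpose-inverse b a))

det-equal-rows : ∀ {k} (j : Fin k) (A : Matrix (suc k)) → (∀ l → A zero l ≡ A (suc j) l) → det A ≡ + 0
det-equal-rows {suc k} j A rows≡ = begin
  det A                        ≡⟨ sym (det-conj-injective τ (transpose-injective _ _) A) ⟩
  det (λ x y → A (τ x) (τ y))  ≡⟨ det-equal-rows₀₁ (λ x y → A (τ x) (τ y)) (λ l → rows≡ (τ l)) ⟩
  + 0                          ∎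
  where
  open ≡-Reasoning
  τ = PC.transpose (suc zero) (suc j)

det-equal-cols : ∀ {k} (j : Fin k) (A : Matrix (suc k)) → (∀ i → A i zero ≡ A i (suc j)) → det A ≡ + 0
det-equal-cols {suc k} j A cols≡ = begin
  det A                        ≡⟨ sym (det-conj-injective τ (transpose-injective _ _) A) ⟩
  det Aτ                       ≡⟨ x≡-x⇒x≡0 (det Aτ) (trans (sym (det-cong swap-fixes)) (det-swap-cols zero Aτ)) ⟩
  + 0                          ∎
  where
  open ≡-Reasoning
  τ = PC.transpose (suc zero) (suc j)
  Aτ : Matrix (suc (suc k))
  Aτ x y = A (τ x) (τ y)
  swap-fixes : ∀ x y → Aτ x (adjacentSwap zero y) ≡ Aτ x y
  swap-fixes x zero          = sym (cols≡ (τ x))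
  swap-fixes x (suc zero)    = cols≡ (τ x)
  swap-fixes x (suc (suc y)) = refl

x+c*0≡x : ∀ x c → x + c * + 0 ≡ x
x+c*0≡x x c = trans (cong (λ y → x + y) (*-zeroʳ c)) (+-identityʳ x)

det-addRow : ∀ {k} (j : Fin k) (c : ℤ) (A B : Matrix (suc k)) →
  (∀ l → B zero l ≡ A zero l + c * A (suc j) l) → (∀ i l → B (suc i) l ≡ A (suc i) l) → det B ≡ det A
det-addRow j c A B B₀ Bₛ = begin
  det B              ≡⟨ det-linear-row zero c A A′ B B₀ (λ { zero l 0≢0 → ⊥-elim (0≢0 refl) ; (suc i) l _ → Bₛ i l })
                                                      (λ { zero l 0≢0 → ⊥-elim (0≢0 refl) ; (suc i) l _ → refl }) ⟩
  det A + c * det A′ ≡⟨ cong (λ d → det A + c * d) (det-equal-rows j A′ (λ _ → refl)) ⟩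
  det A + c * + 0    ≡⟨ x+c*0≡x (det A) c ⟩
  det A              ∎
  where
  open ≡-Reasoning
  A′ : Matrix _
  A′ zero    l = A (suc j) l
  A′ (suc i) l = A (suc i) l

det-addCol : ∀ {k} (j : Fin k) (c : ℤ) (A B : Matrix (suc k)) →
  (∀ i → B i zero ≡ A i zero + c * A i (suc j)) → (∀ i l → B i (suc l) ≡ A i (suc l)) → det B ≡ det A
det-addCol j c A B B₀ Bₛ = begin
  det B              ≡⟨ det-linear-col zero c A A′ B B₀ (λ { i zero 0≢0 → ⊥-elim (0≢0 refl) ; i (suc l) _ → Bₛ i l })
                                                      (λ { i zero 0≢0 → ⊥-elim (0≢0 refl) ; i (suc l) _ → refl }) ⟩
  det A + c * det A′ ≡⟨ cong (λ d → det A + c * d) (det-equal-cols j A′ (λ _ → refl)) ⟩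
  det A + c * + 0    ≡⟨ x+c*0≡x (det A) c ⟩
  det A              ∎
  where
  open ≡-Reasoning
  A′ : Matrix _
  A′ i zero    = A i (suc j)
  A′ i (suc l) = A i (suc l)

det-row₀+row₁-row₂-row₃ : ∀ {k} (A B : Matrix (4 ℕ.+ k)) →
  (∀ l → B zero l ≡ A 0F l + A 1F l - A 2F l - A 3F l) → (∀ i l → B (suc i) l ≡ A (suc i) l) →
  det B ≡ det A
det-row₀+row₁-row₂-row₃ A B B₀ Bₛ =
  trans (det-addRow 2F -1ℤ B₂ B (λ l → trans (B₀ l) (minus (A 0F l + A 1F l - A 2F l) (A 3F l))) Bₛ)
 (trans (det-addRow 1F -1ℤ B₁ B₂ (λ l → minus (A 0F l + A 1F l) (A 2F l)) (λ _ _ → refl))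
        (det-addRow 0F (+ 1) A B₁ (λ l → cong (λ x → A 0F l + x) (sym (*-identityˡ (A 1F l)))) (λ _ _ → refl)))
  where
  minus : ∀ x y → x - y ≡ x + -1ℤ * y
  minus x y = cong (λ z → x + z) (sym (-1*i≡-i y))
  B₁ B₂ : Matrix _
  B₁ zero    l = A 0F l + A 1F l
  B₁ (suc i) l = A (suc i) l
  B₂ zero    l = A 0F l + A 1F l - A 2F l
  B₂ (suc i) l = A (suc i) l

det-row₀-three : ∀ {k} (A : Matrix (3 ℕ.+ k)) → (∀ j → A zero (suc (suc (suc j))) ≡ + 0) →
  det A ≡ A zero 0F * det (minor A 0F) - A zero 1F * det (minor A 1F) + A zero 2F * det (minor A 2F)
det-row₀-three A row₀ = begin
  laplaceTerm A 0F + (laplaceTerm A 1F + (laplaceTerm A 2F + sumFin (λ j → laplaceTerm A (suc (suc (suc j))))))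
    ≡⟨ cong (λ r → laplaceTerm A 0F + (laplaceTerm A 1F + (laplaceTerm A 2F + r)))
            (sumFin-zero (λ j → laplaceTerm A (suc (suc (suc j)))) rest) ⟩
  laplaceTerm A 0F + (laplaceTerm A 1F + (laplaceTerm A 2F + + 0))
    ≡⟨ expand (A zero 0F) (A zero 1F) (A zero 2F) (det (minor A 0F)) (det (minor A 1F)) (det (minor A 2F)) ⟩
  A zero 0F * det (minor A 0F) - A zero 1F * det (minor A 1F) + A zero 2F * det (minor A 2F) ∎
  where
  open ≡-Reasoning
  rest : ∀ j → laplaceTerm A (suc (suc (suc j))) ≡ + 0
  rest j = trans (cong (λ x → sign (toℕ (suc (suc (suc j)))) * x * det (minor A (suc (suc (suc j))))) (row₀ j))
                 (vanish (sign (toℕ j)) (det (minor A (suc (suc (suc j))))))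
    where vanish : ∀ s d → - - - s * + 0 * d ≡ + 0
          vanish = solve-∀
  expand : ∀ a b c d₀ d₁ d₂ → + 1 * a * d₀ + (- + 1 * b * d₁ + (+ 1 * c * d₂ + + 0)) ≡ a * d₀ - b * d₁ + c * d₂
  expand = solve-∀

det₃ : (a b c d e f g h i : ℤ) → ℤ
det₃ a b c d e f g h i = a * (e * i - f * h) - b * (d * i - f * g) + c * (d * h - e * g)

det-3×3 : ∀ (A : Matrix 3) →
  det A ≡ det₃ (A 0F 0F) (A 0F 1F) (A 0F 2F) (A 1F 0F) (A 1F 1F) (A 1F 2F) (A 2F 0F) (A 2F 1F) (A 2F 2F)
det-3×3 A = expand (A 0F 0F) (A 0F 1F) (A 0F 2F) (A 1F 0F) (A 1F 1F) (A 1F 2F) (A 2F 0F) (A 2F 1F) (A 2F 2F)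
  where
  expand : ∀ a b c d e f g h i →
    + 1 * a * (+ 1 * e * (+ 1 * i * + 1 + + 0) + (- + 1 * f * (+ 1 * h * + 1 + + 0) + + 0))
    + (- + 1 * b * (+ 1 * d * (+ 1 * i * + 1 + + 0) + (- + 1 * f * (+ 1 * g * + 1 + + 0) + + 0))
    + (+ 1 * c * (+ 1 * d * (+ 1 * h * + 1 + + 0) + (- + 1 * e * (+ 1 * g * + 1 + + 0) + + 0)) + + 0))
    ≡ a * (e * i - f * h) - b * (d * i - f * g) + c * (d * h - e * g)
  expand = solve-∀

det₃-cong : ∀ a b c d e f g h i {a′ b′ c′ d′ e′ f′ g′ h′ i′} →
  a ≡ a′ → b ≡ b′ → c ≡ c′ → d ≡ d′ → e ≡ e′ → f ≡ f′ → g ≡ g′ → h ≡ h′ → i ≡ i′ →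
  det₃ a b c d e f g h i ≡ det₃ a′ b′ c′ d′ e′ f′ g′ h′ i′
det₃-cong a b c d e f g h i refl refl refl refl refl refl refl refl refl = refl

det-row₀-single : ∀ {k} (A : Matrix (suc k)) (c : Fin (suc k)) → (∀ j → j ≢ c → A zero j ≡ + 0) →
                  det A ≡ laplaceTerm A c
det-row₀-single A c row₀ = begin
  det A                                          ≡⟨ sumFin-punchIn c (laplaceTerm A) ⟩
  laplaceTerm A c + sumFin (laplaceTerm A ∘ punchIn c) ≡⟨ cong (λ x → laplaceTerm A c + x) (sumFin-zero _ rest) ⟩
  laplaceTerm A c + + 0                          ≡⟨ +-identityʳ _ ⟩
  laplaceTerm A c                                ∎
  where
  open ≡-Reasoning
  rest : ∀ l → laplaceTerm A (punchIn c l) ≡ + 0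
  rest l = begin
    sign (toℕ (punchIn c l)) * A zero (punchIn c l) * det (minor A (punchIn c l))
      ≡⟨ cong (λ x → sign (toℕ (punchIn c l)) * x * det (minor A (punchIn c l))) (row₀ (punchIn c l) (punchInᵢ≢i c l)) ⟩
    sign (toℕ (punchIn c l)) * + 0 * det (minor A (punchIn c l))
      ≡⟨ cong (_* det (minor A (punchIn c l))) (*-zeroʳ (sign (toℕ (punchIn c l)))) ⟩
    + 0 ∎

-- The matrices Ψ t n = [ψ t ∣i − j∣]

-- For t = K and d ≤ 2K, ψ t d is the distance between two vertices of the labelled cycle of pathLabel whose
-- labels differ by d.
ψ : ℤ → ℕ → ℤ
ψ t zero          = + 0
ψ t (suc zero)    = t
ψ t (suc (suc d)) = ψ t d + sign d

Ψ : ℤ → (n : ℕ) → Matrix n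
Ψ t n i j = ψ t ∣ toℕ i - toℕ j ∣

∣n-k+n∣≡k : ∀ n k → ∣ n - k ℕ.+ n ∣ ≡ k
∣n-k+n∣≡k n k = trans (cong (λ x → ∣ n - x ∣) (ℕP.+-comm k n)) (ℕP.∣m-m+n∣≡n n k)

sign+sign-suc : ∀ d → sign d + sign (suc d) ≡ + 0
sign+sign-suc d = ℤP.+-inverseʳ (sign d)

ψ-four-descending : ∀ t d → ψ t d + ψ t (suc d) - ψ t (suc (suc d)) - ψ t (suc (suc (suc d))) ≡ + 0
ψ-four-descending t d =
  trans (regroup (ψ t d) (ψ t (suc d)) (sign d) (sign (suc d))) (cong -_ (sign+sign-suc d))
  where regroup : ∀ a b x y → a + b - (a + x) - (b + y) ≡ - (x + y)
        regroup = solve-∀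

ψ-four-ascending : ∀ t d → ψ t (suc (suc (suc d))) + ψ t (suc (suc d)) - ψ t (suc d) - ψ t d ≡ + 0
ψ-four-ascending t d =
  trans (regroup (ψ t d) (ψ t (suc d)) (sign d) (sign (suc d))) (sign+sign-suc d)
  where regroup : ∀ a b x y → b + y + (a + x) - b - a ≡ x + y
        regroup = solve-∀

stepRow : ℕ → ℕ → ℤ
stepRow zero    zero                = + 0
stepRow zero    (suc zero)          = -1ℤ
stepRow zero    (suc (suc zero))    = + 1
stepRow zero    (suc (suc (suc j))) = + 0
stepRow (suc i) zero                = + 0
stepRow (suc i) (suc j)             = stepRow i j

ψ-four-rows : ∀ t i j →
  ψ t (∣ i - j ∣) + ψ t (∣ suc i - j ∣) - ψ t (∣ suc (suc i) - j ∣) - ψ t (∣ suc (suc (suc i)) - j ∣)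
    ≡ stepRow i j
ψ-four-rows t zero zero = close t
  where close : ∀ t → + 0 + t - (+ 0 + + 1) - (t + -1ℤ) ≡ + 0
        close = solve-∀
ψ-four-rows t zero (suc zero) = close t
  where close : ∀ t → t + + 0 - t - (+ 0 + + 1) ≡ -1ℤ
        close = solve-∀
ψ-four-rows t zero (suc (suc zero)) = close t
  where close : ∀ t → + 0 + + 1 + t - + 0 - t ≡ + 1
        close = solve-∀
ψ-four-rows t zero    (suc (suc (suc j))) = ψ-four-ascending t j
ψ-four-rows t (suc i) zero                = ψ-four-descending t (suc i)
ψ-four-rows t (suc i) (suc j)             = ψ-four-rows t i j

sumBelow : ℕ → (ℕ → ℤ) → ℤ
sumBelow zero    g = + 0
sumBelow (suc n) g = g zero + sumBelow n (g ∘ suc)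

sumBelow-cong : ∀ n {g h : ℕ → ℤ} → (∀ l → g l ≡ h l) → sumBelow n g ≡ sumBelow n h
sumBelow-cong zero    g≗h = refl
sumBelow-cong (suc n) g≗h = cong₂ _+_ (g≗h zero) (sumBelow-cong n (g≗h ∘ suc))

sumBelow-snoc : ∀ n (g : ℕ → ℤ) → sumBelow (suc n) g ≡ sumBelow n g + g n
sumBelow-snoc zero    g = trans (+-identityʳ (g zero)) (sym (+-identityˡ (g zero)))
sumBelow-snoc (suc n) g =
  trans (cong (λ x → g zero + x) (sumBelow-snoc n (g ∘ suc))) (sym (ℤP.+-assoc (g zero) _ _))

sumBelow-reverse : ∀ n (g : ℕ → ℤ) → sumBelow n (λ l → g ∣ n - suc l ∣) ≡ sumBelow n g
sumBelow-reverse zero    g = refl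
sumBelow-reverse (suc n) g = begin
  g ∣ n - 0 ∣ + sumBelow n (λ l → g ∣ n - suc l ∣)
    ≡⟨ cong₂ _+_ (cong g (ℕP.∣-∣-identityʳ n)) (sumBelow-reverse n g) ⟩
  g n + sumBelow n g                                ≡⟨ ℤP.+-comm (g n) (sumBelow n g) ⟩
  sumBelow n g + g n                                ≡⟨ sym (sumBelow-snoc n g) ⟩
  sumBelow (suc n) g                                ∎
  where open ≡-Reasoning

sumBelow-four : ∀ n (a b c d : ℕ → ℤ) →
  sumBelow n a + sumBelow n b - sumBelow n c - sumBelow n d ≡ sumBelow n (λ l → a l + b l - c l - d l)
sumBelow-four zero    a b c d = refl
sumBelow-four (suc n) a b c d =
  trans (regroup (a 0) (b 0) (c 0) (d 0) _ _ _ _)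
        (cong (λ x → a 0 + b 0 - c 0 - d 0 + x) (sumBelow-four n (a ∘ suc) (b ∘ suc) (c ∘ suc) (d ∘ suc)))
  where regroup : ∀ a b c d x y z w → (a + x) + (b + y) - (c + z) - (d + w) ≡ (a + b - c - d) + (x + y - z - w)
        regroup = solve-∀

stepRow-zeroʳ : ∀ i → stepRow i 0 ≡ + 0
stepRow-zeroʳ zero    = refl
stepRow-zeroʳ (suc i) = refl

stepRow-shift : ∀ s j → stepRow s (j ℕ.+ s) ≡ stepRow 0 j
stepRow-shift zero    j = cong (stepRow 0) (ℕP.+-identityʳ j)
stepRow-shift (suc s) j = trans (cong (stepRow (suc s)) (ℕP.+-suc j s)) (stepRow-shift s j)

sumBelow-stepRow : ∀ s → sumBelow (suc s) (λ l → stepRow s (suc l)) ≡ -1ℤ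
sumBelow-stepRow zero    = refl
sumBelow-stepRow (suc s) =
  trans (cong (_+ sumBelow (suc s) (λ l → stepRow s (suc l))) (stepRow-zeroʳ s))
        (trans (+-identityˡ _) (sumBelow-stepRow s))

-- Row R of Ψ t (s + n) with columns 1, …, s + 1 replaced by their sum; the rows kept are R = s, …, s + n − 1.
contractedEntry : ℤ → ℕ → ℕ → ℕ → ℤ
contractedEntry t s R zero          = ψ t (∣ R - 0 ∣)
contractedEntry t s R (suc zero)    = sumBelow (suc s) (λ l → ψ t (∣ R - suc l ∣))
contractedEntry t s R (suc (suc j)) = ψ t (∣ R - suc (suc (j ℕ.+ s)) ∣)

Contracted : ℤ → ℕ → (n : ℕ) → Matrix n
Contracted t s n i j = contractedEntry t s (toℕ i ℕ.+ s) (toℕ j)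

contracted-four-rows : ∀ t s c →
  contractedEntry t s s c + contractedEntry t s (suc s) c
    - contractedEntry t s (suc (suc s)) c - contractedEntry t s (suc (suc (suc s))) c ≡ stepRow 0 c
contracted-four-rows t s zero = trans (ψ-four-rows t s 0) (stepRow-zeroʳ s)
contracted-four-rows t s (suc zero) = begin
  _ ≡⟨ sumBelow-four (suc s) (entry s) (entry (suc s)) (entry (suc (suc s))) (entry (suc (suc (suc s)))) ⟩
  _ ≡⟨ sumBelow-cong (suc s) (λ l → ψ-four-rows t s (suc l)) ⟩
  sumBelow (suc s) (λ l → stepRow s (suc l)) ≡⟨ sumBelow-stepRow s ⟩
  -1ℤ ∎
  where
  open ≡-Reasoning
  entry : ℕ → ℕ → ℤ
  entry R l = ψ t (∣ R - suc l ∣)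
contracted-four-rows t s (suc (suc j)) =
  trans (ψ-four-rows t s (suc (suc (j ℕ.+ s)))) (stepRow-shift s (suc (suc j)))

det-stepRow₀ : ∀ {k} (B : Matrix (3 ℕ.+ k)) → (∀ j → B zero j ≡ stepRow 0 (toℕ j)) →
               det B ≡ det (minor B 1F) + det (minor B 2F)
det-stepRow₀ B B₀ = begin
  det B
    ≡⟨ det-row₀-three B (λ j → B₀ (suc (suc (suc j)))) ⟩
  B zero 0F * d₀ - B zero 1F * d₁ + B zero 2F * d₂
    ≡⟨ cong₃ (λ x y z → x * d₀ - y * d₁ + z * d₂) (B₀ 0F) (B₀ 1F) (B₀ 2F) ⟩
  + 0 * d₀ - -1ℤ * d₁ + + 1 * d₂
    ≡⟨ simplify d₀ d₁ d₂ ⟩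
  d₁ + d₂ ∎
  where
  open ≡-Reasoning
  d₀ = det (minor B 0F)
  d₁ = det (minor B 1F)
  d₂ = det (minor B 2F)
  simplify : ∀ d₀ d₁ d₂ → + 0 * d₀ - -1ℤ * d₁ + + 1 * d₂ ≡ d₁ + d₂
  simplify = solve-∀

-- Replacing row 0 by R₀ + R₁ − R₂ − R₃ = −e₁ + e₂ and expanding it merges columns 1 and 2.
det-contract-step : ∀ t s m → det (Contracted t s (4 ℕ.+ m)) ≡ det (Contracted t (suc s) (3 ℕ.+ m))
det-contract-step t s m = begin
  det C
    ≡⟨ sym (det-row₀+row₁-row₂-row₃ C B (λ l → sym (contracted-four-rows t s (toℕ l))) (λ _ _ → refl)) ⟩
  det B
    ≡⟨ det-stepRow₀ B (λ _ → refl) ⟩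
  det (minor B 1F) + det (minor B 2F)
    ≡⟨ ℤP.+-comm (det (minor B 1F)) (det (minor B 2F)) ⟩
  det (minor B 2F) + det (minor B 1F)
    ≡⟨ sym (det-additive-col 1F (minor B 2F) (minor B 1F) C′ merged C′≡ other≡) ⟩
  det C′ ∎
  where
  open ≡-Reasoning
  C = Contracted t s (4 ℕ.+ m)
  C′ = Contracted t (suc s) (3 ℕ.+ m)
  B : Matrix (4 ℕ.+ m)
  B zero    l = stepRow 0 (toℕ l)
  B (suc i) l = C (suc i) l
  row : ∀ (i : Fin (3 ℕ.+ m)) → toℕ i ℕ.+ suc s ≡ suc (toℕ i ℕ.+ s)
  row i = ℕP.+-suc (toℕ i) s
  merged : ∀ i → C′ i 1F ≡ minor B 2F i 1F + minor B 1F i 1F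
  merged i rewrite row i = sumBelow-snoc (suc s) (λ l → ψ t (∣ suc (toℕ i ℕ.+ s) - suc l ∣))
  C′≡ : ∀ i l → l ≢ 1F → C′ i l ≡ minor B 2F i l
  C′≡ i zero          _   = cong (λ R → ψ t (∣ R - 0 ∣)) (row i)
  C′≡ i (suc zero)    1≢1 = ⊥-elim (1≢1 refl)
  C′≡ i (suc (suc l)) _   = cong₂ (λ R c → ψ t (∣ R - suc (suc c) ∣)) (row i) (ℕP.+-suc (toℕ l) s)
  other≡ : ∀ i l → l ≢ 1F → minor B 1F i l ≡ minor B 2F i l
  other≡ i zero          _   = refl
  other≡ i (suc zero)    1≢1 = ⊥-elim (1≢1 refl)
  other≡ i (suc (suc l)) _   = refl

det-contracted : ∀ t m s → det (Contracted t s (3 ℕ.+ m)) ≡ det (Contracted t (m ℕ.+ s) 3)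
det-contracted t zero    s = refl
det-contracted t (suc m) s =
  trans (det-contract-step t s m)
        (trans (det-contracted t m (suc s)) (cong (λ s′ → det (Contracted t s′ 3)) (ℕP.+-suc m s)))

det-Ψ≡det-Contracted₀ : ∀ t n → det (Ψ t n) ≡ det (Contracted t 0 n)
det-Ψ≡det-Contracted₀ t n = det-cong entry
  where
  entry : ∀ i j → Ψ t n i j ≡ Contracted t 0 n i j
  entry i j with toℕ j
  ... | zero        = cong (λ R → ψ t (∣ R - 0 ∣)) (sym (ℕP.+-identityʳ (toℕ i)))
  ... | suc zero    = trans (cong (λ R → ψ t (∣ R - 1 ∣)) (sym (ℕP.+-identityʳ (toℕ i)))) (sym (+-identityʳ _))
  ... | suc (suc c) = cong₂ (λ R c → ψ t (∣ R - suc (suc c) ∣)) (sym (ℕP.+-identityʳ (toℕ i))) (sym (ℕP.+-identityʳ c))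

ψSum : ℤ → ℕ → ℤ
ψSum t n = sumBelow n (ψ t)

D₃ : ℤ → ℕ → ℤ
D₃ t s = det₃ (ψ t s)               (ψSum t s + t)          (+ 1)
              (ψ t (suc s))         (ψSum t (suc s))        t
              (ψ t (suc (suc s)))   (ψSum t (suc (suc s)))  (+ 0)

det-Contracted₃ : ∀ t s → det (Contracted t s 3) ≡ D₃ t s
det-Contracted₃ t s = trans (det-3×3 C) (det₃-cong
  (C 0F 0F) (C 0F 1F) (C 0F 2F) (C 1F 0F) (C 1F 1F) (C 1F 2F) (C 2F 0F) (C 2F 1F) (C 2F 2F)
  (cong (ψ t) (ℕP.∣-∣-identityʳ s)) row₀-sum  (cong (ψ t) (∣n-k+n∣≡k s 2))
  refl                               row₁-sum  (cong (ψ t) (∣n-k+n∣≡k s 1))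
  refl                               row₂-sum  (cong (ψ t) (ℕP.∣n-n∣≡0 s)))
  where
  C = Contracted t s 3
  row₀-sum : sumBelow (suc s) (λ l → ψ t (∣ s - suc l ∣)) ≡ ψSum t s + t
  row₀-sum = trans (sumBelow-snoc s (λ l → ψ t (∣ s - suc l ∣)))
                   (cong₂ _+_ (sumBelow-reverse s (ψ t)) (cong (ψ t) (∣n-k+n∣≡k s 1)))
  row₁-sum : sumBelow (suc s) (λ l → ψ t (∣ s - l ∣)) ≡ ψSum t (suc s)
  row₁-sum = sumBelow-reverse (suc s) (ψ t)
  row₂-sum : sumBelow (suc s) (λ l → ψ t (∣ suc s - l ∣)) ≡ ψSum t (suc (suc s))
  row₂-sum = begin
    sumBelow (suc s) (λ l → ψ t (∣ suc s - l ∣))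
      ≡⟨ sym (+-identityʳ _) ⟩
    sumBelow (suc s) (λ l → ψ t (∣ suc s - l ∣)) + ψ t 0
      ≡⟨ cong (λ x → sumBelow (suc s) (λ l → ψ t (∣ suc s - l ∣)) + ψ t x) (sym (ℕP.∣n-n∣≡0 s)) ⟩
    sumBelow (suc s) (λ l → ψ t (∣ suc s - l ∣)) + ψ t (∣ suc s - suc s ∣)
      ≡⟨ sym (sumBelow-snoc (suc s) (λ l → ψ t (∣ suc s - l ∣))) ⟩
    sumBelow (suc (suc s)) (λ l → ψ t (∣ suc s - l ∣))
      ≡⟨ sumBelow-reverse (suc (suc s)) (ψ t) ⟩
    ψSum t (suc (suc s)) ∎
    where open ≡-Reasoning

det-Ψ : ∀ t m → det (Ψ t (3 ℕ.+ m)) ≡ D₃ t m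
det-Ψ t m = begin
  det (Ψ t (3 ℕ.+ m))               ≡⟨ det-Ψ≡det-Contracted₀ t (3 ℕ.+ m) ⟩
  det (Contracted t 0 (3 ℕ.+ m))    ≡⟨ det-contracted t m 0 ⟩
  det (Contracted t (m ℕ.+ 0) 3)    ≡⟨ cong (λ s → det (Contracted t s 3)) (ℕP.+-identityʳ m) ⟩
  det (Contracted t m 3)            ≡⟨ det-Contracted₃ t m ⟩
  D₃ t m                            ∎
  where open ≡-Reasoning

twice : ℕ → ℕ
twice zero    = zero
twice (suc a) = suc (suc (twice a))

twice-mono : ∀ {a b} → a ℕ.≤ b → twice a ℕ.≤ twice b
twice-mono z≤n       = z≤n
twice-mono (s≤s a≤b) = s≤s (s≤s (twice-mono a≤b))

twice+1≤twice-suc⇒≤ : ∀ a b → suc (twice a) ℕ.≤ twice (suc b) → a ℕ.≤ b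
twice+1≤twice-suc⇒≤ zero    b       _                 = z≤n
twice+1≤twice-suc⇒≤ (suc a) zero    (s≤s (s≤s ()))
twice+1≤twice-suc⇒≤ (suc a) (suc b) (s≤s (s≤s a≤b)) = s≤s (twice+1≤twice-suc⇒≤ a b a≤b)

twice-+ : ∀ a b → twice (a ℕ.+ b) ≡ twice a ℕ.+ twice b
twice-+ zero    b = refl
twice-+ (suc a) b = cong (λ x → suc (suc x)) (twice-+ a b)

twice-injective : ∀ a b → twice a ≡ twice b → a ≡ b
twice-injective zero    zero    _  = refl
twice-injective (suc a) (suc b) eq = cong suc (twice-injective a b (ℕP.suc-injective (ℕP.suc-injective eq)))

twice≢suc-twice : ∀ a b → twice a ≢ suc (twice b)
twice≢suc-twice (suc a) (suc b) eq = twice≢suc-twice a b (ℕP.suc-injective (ℕP.suc-injective eq))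

twice≡2* : ∀ a → twice a ≡ 2 ℕ.* a
twice≡2* zero    = refl
twice≡2* (suc a) = trans (cong (λ x → suc (suc x)) (twice≡2* a)) (sym (ℕP.*-suc 2 a))

∣twice-twice∣ : ∀ p d → ∣ twice p - twice (d ℕ.+ p) ∣ ≡ twice d
∣twice-twice∣ p d = trans (cong (λ x → ∣ twice p - x ∣) (twice-+ d p)) (∣n-k+n∣≡k (twice p) (twice d))

∣twice-twice+1∣ : ∀ p d → ∣ twice p - suc (twice (d ℕ.+ p)) ∣ ≡ suc (twice d)
∣twice-twice+1∣ p d = trans (cong (λ x → ∣ twice p - suc x ∣) (twice-+ d p)) (∣n-k+n∣≡k (twice p) (suc (twice d)))

∣twice-suc-twice+1∣ : ∀ q d → ∣ twice (suc (d ℕ.+ q)) - suc (twice q) ∣ ≡ suc (twice d)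
∣twice-suc-twice+1∣ q d = begin
  ∣ suc (twice (d ℕ.+ q)) - twice q ∣              ≡⟨ cong (λ x → ∣ suc x - twice q ∣) (twice-+ d q) ⟩
  ∣ suc (twice d) ℕ.+ twice q - twice q ∣           ≡⟨ ℕP.∣-∣-comm (suc (twice d) ℕ.+ twice q) (twice q) ⟩
  ∣ twice q - suc (twice d) ℕ.+ twice q ∣           ≡⟨ ∣n-k+n∣≡k (twice q) (suc (twice d)) ⟩
  suc (twice d)                                     ∎
  where open ≡-Reasoning

sign-twice : ∀ a → sign (twice a) ≡ + 1
sign-twice zero    = refl
sign-twice (suc a) = trans (ℤP.neg-involutive (sign (twice a))) (sign-twice a)

ψ-twice : ∀ t a → ψ t (twice a) ≡ + a
ψ-twice t zero    = refl
ψ-twice t (suc a) rewrite ψ-twice t a | sign-twice a = cong +_ (ℕP.+-comm a 1)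

ψ-twice+1 : ∀ t a → ψ t (suc (twice a)) ≡ t - + a
ψ-twice+1 t zero    = sym (+-identityʳ t)
ψ-twice+1 t (suc a) rewrite ψ-twice+1 t a | sign-twice a = regroup t (+ a)
  where regroup : ∀ t a → t - a + - + 1 ≡ t - (+ 1 + a)
        regroup = solve-∀

ψSum-twice : ∀ t a → ψSum t (twice a) ≡ + a * t
ψSum-twice t zero    = refl
ψSum-twice t (suc a) = begin
  ψSum t (suc (suc (twice a)))                          ≡⟨ sumBelow-snoc (suc (twice a)) (ψ t) ⟩
  ψSum t (suc (twice a)) + ψ t (suc (twice a))          ≡⟨ cong (_+ ψ t (suc (twice a))) (sumBelow-snoc (twice a) (ψ t)) ⟩
  ψSum t (twice a) + ψ t (twice a) + ψ t (suc (twice a)) ≡⟨ cong₂ (λ x y → x + ψ t (twice a) + y) (ψSum-twice t a) (ψ-twice+1 t a) ⟩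
  + a * t + ψ t (twice a) + (t - + a)                   ≡⟨ cong (λ x → + a * t + x + (t - + a)) (ψ-twice t a) ⟩
  + a * t + + a + (t - + a)                             ≡⟨ regroup t (+ a) ⟩
  (+ 1 + + a) * t                                       ∎
  where open ≡-Reasoning
        regroup : ∀ t a → a * t + a + (t - a) ≡ (+ 1 + a) * t
        regroup = solve-∀

ψSum-twice+1 : ∀ t a → ψSum t (suc (twice a)) ≡ + a * (t + + 1)
ψSum-twice+1 t a =
  trans (sumBelow-snoc (twice a) (ψ t)) (trans (cong₂ _+_ (ψSum-twice t a) (ψ-twice t a)) (regroup t (+ a)))
  where regroup : ∀ t a → a * t + a ≡ a * (t + + 1)
        regroup = solve-∀

D₃-twice : ∀ t a → D₃ t (twice a) ≡ (+ a + + 1) * (+ 2 * t * t - + 2 * + a * t - + a)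
D₃-twice t a = trans
  (det₃-cong (ψ t (twice a)) (ψSum t (twice a) + t) (+ 1)
             (ψ t (suc (twice a))) (ψSum t (suc (twice a))) t
             (ψ t (twice (suc a))) (ψSum t (twice (suc a))) (+ 0)
    (ψ-twice t a) (cong (_+ t) (ψSum-twice t a)) refl
    (ψ-twice+1 t a) (ψSum-twice+1 t a) refl
    (ψ-twice t (suc a)) (ψSum-twice t (suc a)) refl)
  (expand t (+ a))
  where
  expand : ∀ t a →
    a * (a * (t + + 1) * + 0 - t * ((+ 1 + a) * t)) - (a * t + t) * ((t - a) * + 0 - t * (+ 1 + a))
      + + 1 * ((t - a) * ((+ 1 + a) * t) - a * (t + + 1) * (+ 1 + a))
      ≡ (a + + 1) * (+ 2 * t * t - + 2 * a * t - a)
  expand = solve-∀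

D₃-twice+1 : ∀ t a → let A = + a + + 1 in
  D₃ t (suc (twice a)) ≡ A * A * (+ 2 * t + + 1) - t * t * (+ 2 * A + + 1)
D₃-twice+1 t a = trans
  (det₃-cong (ψ t (suc (twice a))) (ψSum t (suc (twice a)) + t) (+ 1)
             (ψ t (twice (suc a))) (ψSum t (twice (suc a))) t
             (ψ t (suc (twice (suc a)))) (ψSum t (suc (twice (suc a)))) (+ 0)
    (ψ-twice+1 t a) (cong (_+ t) (ψSum-twice+1 t a)) refl
    (ψ-twice t (suc a)) (ψSum-twice t (suc a)) refl
    (ψ-twice+1 t (suc a)) (ψSum-twice+1 t (suc a)) refl)
  (expand t (+ a))
  where
  expand : ∀ t a →
    (t - a) * ((+ 1 + a) * t * + 0 - t * ((+ 1 + a) * (t + + 1)))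
      - (a * (t + + 1) + t) * ((+ 1 + a) * + 0 - t * (t - (+ 1 + a)))
      + + 1 * ((+ 1 + a) * ((+ 1 + a) * (t + + 1)) - (+ 1 + a) * t * (t - (+ 1 + a)))
      ≡ (a + + 1) * (a + + 1) * (+ 2 * t + + 1) - t * t * (+ 2 * (a + + 1) + + 1)
  expand = solve-∀

det-Ψ-odd : ∀ k → det (Ψ (+ suc k) (3 ℕ.+ twice k)) ≡ + suc k * + suc (suc k)
det-Ψ-odd k = trans (det-Ψ (+ suc k) (twice k)) (trans (D₃-twice (+ suc k) k) (evaluate (+ k)))
  where evaluate : ∀ k → (k + + 1) * (+ 2 * (+ 1 + k) * (+ 1 + k) - + 2 * k * (+ 1 + k) - k)
                           ≡ (+ 1 + k) * (+ 2 + k)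
        evaluate = solve-∀

det-Ψ-even : ∀ k → det (Ψ (+ suc (suc k)) (4 ℕ.+ twice k)) ≡ + 1 - + 2 * (+ suc (suc k) * + suc (suc k))
det-Ψ-even k = trans (det-Ψ (+ suc (suc k)) (suc (twice k))) (trans (D₃-twice+1 (+ suc (suc k)) k) (evaluate (+ k)))
  where evaluate : ∀ k → (k + + 1) * (k + + 1) * (+ 2 * (+ 2 + k) + + 1) - (+ 2 + k) * (+ 2 + k) * (+ 2 * (k + + 1) + + 1)
                           ≡ + 1 - + 2 * ((+ 2 + k) * (+ 2 + k))
        evaluate = solve-∀

-- Bordered matrices

-- Indices 0, …, r − 1 are r hub vertices, pairwise at distance 2, followed by the labels 1, …, N of Ψ t (suc N),
-- whose label 0 every hub occupies: a hub is at distance ψ t (b + 1) from the label b + 1.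
border : ℤ → (r N : ℕ) → Fin (r ℕ.+ N) → ℤ
border t zero    N b       = ψ t (suc (toℕ b))
border t (suc r) N zero    = + 2
border t (suc r) N (suc b) = border t r N b

Bordered : ℤ → (r N : ℕ) → Matrix (r ℕ.+ N)
Bordered t zero    N i       j       = Ψ t N i j
Bordered t (suc r) N zero    zero    = + 0
Bordered t (suc r) N zero    (suc j) = border t r N j
Bordered t (suc r) N (suc i) zero    = border t r N i
Bordered t (suc r) N (suc i) (suc j) = Bordered t r N i j

Bordered₂ : ℤ → (r N : ℕ) → Matrix (suc r ℕ.+ N)
Bordered₂ t r N zero    zero    = + 2
Bordered₂ t r N zero    (suc j) = border t r N j
Bordered₂ t r N (suc i) zero    = border t r N i
Bordered₂ t r N (suc i) (suc j) = Bordered t r N i j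

-2ℤ : ℤ
-2ℤ = - + 2

det-Bordered₁ : ∀ t N → det (Bordered t 1 N) ≡ det (Ψ t (suc N))
det-Bordered₁ t N = det-cong {A = Bordered t 1 N} {B = Ψ t (suc N)}
  λ { zero zero → refl ; zero (suc j) → refl ; (suc i) zero → refl ; (suc i) (suc j) → refl }

det-Bordered₂-zero : ∀ t N → det (Bordered₂ t 0 N) ≡ det (Ψ t (suc N)) + + 2 * det (Ψ t N)
det-Bordered₂-zero t N = begin
  det (Bordered₂ t 0 N)                          ≡⟨ det-linear-row zero (+ 2) (Bordered t 1 N) E (Bordered₂ t 0 N) corner
                                                      (lower (λ { i zero → refl ; i (suc j) → refl })) (lower (λ _ _ → refl)) ⟩
  det (Bordered t 1 N) + + 2 * det E             ≡⟨ cong₂ (λ x y → x + + 2 * y) (det-Bordered₁ t N) det-E ⟩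
  det (Ψ t (suc N)) + + 2 * det (Ψ t N)          ∎
  where
  open ≡-Reasoning
  E : Matrix (suc N)
  E zero    zero    = + 1
  E zero    (suc j) = + 0
  E (suc i) j       = Bordered t 1 N (suc i) j
  lower : ∀ {M : Matrix (suc N)} → (∀ i j → M (suc i) j ≡ Bordered t 1 N (suc i) j) →
          ∀ i j → i ≢ zero → M i j ≡ Bordered t 1 N i j
  lower M≡ zero    j 0≢0 = ⊥-elim (0≢0 refl)
  lower M≡ (suc i) j _   = M≡ i j
  corner : ∀ j → Bordered₂ t 0 N zero j ≡ Bordered t 1 N zero j + + 2 * E zero j
  corner zero    = refl
  corner (suc j) = sym (+-identityʳ _)
  det-E : det E ≡ det (Ψ t N)
  det-E = trans (det-row₀-single E zero (λ { zero 0≢0 → ⊥-elim (0≢0 refl) ; (suc j) _ → refl }))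
                (*-identityˡ (det (Ψ t N)))

x-x≡0 : ∀ x → x + -1ℤ * x ≡ + 0
x-x≡0 = solve-∀

det-Bordered₂-suc : ∀ t r N → det (Bordered₂ t (suc r) N) ≡ -2ℤ * det (Bordered₂ t r N)
det-Bordered₂-suc t r N = begin
  det A                       ≡⟨ sym (det-addRow 0F -1ℤ A B row₀ (λ _ _ → refl)) ⟩
  det B                       ≡⟨ det-row₀-single B 1F off-1 ⟩
  -2ℤ * det (minor B 1F)      ≡⟨ cong (-2ℤ *_) (det-cong minor≡) ⟩
  -2ℤ * det (Bordered₂ t r N) ∎
  where
  open ≡-Reasoning
  A = Bordered₂ t (suc r) N
  B : Matrix (2 ℕ.+ r ℕ.+ N)
  B zero    zero          = + 0
  B zero    (suc zero)    = + 2
  B zero    (suc (suc j)) = + 0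
  B (suc i) j             = A (suc i) j
  row₀ : ∀ l → B zero l ≡ A zero l + -1ℤ * A 1F l
  row₀ zero          = refl
  row₀ (suc zero)    = refl
  row₀ (suc (suc j)) = sym (x-x≡0 (border t r N j))
  off-1 : ∀ j → j ≢ 1F → B zero j ≡ + 0
  off-1 zero          _   = refl
  off-1 (suc zero)    1≢1 = ⊥-elim (1≢1 refl)
  off-1 (suc (suc j)) _   = refl
  minor≡ : ∀ i l → minor B 1F i l ≡ Bordered₂ t r N i l
  minor≡ zero    zero    = refl
  minor≡ zero    (suc l) = refl
  minor≡ (suc i) zero    = refl
  minor≡ (suc i) (suc l) = refl

-- Subtracting row 1 from row 0 and then adding column 1 to column 0 turns row 0 into (0, 2, 0, …, 0).
det-Bordered-suc-suc : ∀ t r N →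
  det (Bordered t (suc (suc r)) N) ≡ -2ℤ * (det (Bordered t (suc r) N) + det (Bordered₂ t r N))
det-Bordered-suc-suc t r N = begin
  det A                          ≡⟨ sym (det-addRow 0F -1ℤ A B₁ (λ _ → refl) (λ _ _ → refl)) ⟩
  det B₁                         ≡⟨ sym (det-addCol 0F (+ 1) B₁ B col₀ colsₛ) ⟩
  det B                          ≡⟨ det-row₀-single B 1F off-1 ⟩
  -2ℤ * det (minor B 1F)         ≡⟨ cong (-2ℤ *_) (det-additive-col 0F (Bordered₂ t r N) (Bordered t (suc r) N) (minor B 1F)
                                                     (λ { zero → refl ; (suc i) → refl })
                                                     (other {minor B 1F} (λ { zero l → refl ; (suc i) l → refl }))
                                                     (other {Bordered t (suc r) N} (λ { zero l → refl ; (suc i) l → refl }))) ⟩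
  -2ℤ * (det (Bordered₂ t r N) + det (Bordered t (suc r) N))
                                 ≡⟨ cong (-2ℤ *_) (ℤP.+-comm (det (Bordered₂ t r N)) (det (Bordered t (suc r) N))) ⟩
  -2ℤ * (det (Bordered t (suc r) N) + det (Bordered₂ t r N)) ∎
  where
  open ≡-Reasoning
  A = Bordered t (suc (suc r)) N
  B₁ B : Matrix (2 ℕ.+ r ℕ.+ N)
  B₁ zero    l = A zero l + -1ℤ * A 1F l
  B₁ (suc i) l = A (suc i) l
  B zero    zero          = + 0
  B zero    (suc zero)    = + 2
  B zero    (suc (suc j)) = + 0
  B (suc i) zero          = A (suc i) 0F + A (suc i) 1F
  B (suc i) (suc j)       = A (suc i) (suc j)
  col₀ : ∀ i → B i zero ≡ B₁ i zero + + 1 * B₁ i 1F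
  col₀ zero    = refl
  col₀ (suc i) = cong (λ x → A (suc i) 0F + x) (sym (*-identityˡ _))
  off-1 : ∀ j → j ≢ 1F → B zero j ≡ + 0
  off-1 zero          _   = refl
  off-1 (suc zero)    1≢1 = ⊥-elim (1≢1 refl)
  off-1 (suc (suc j)) _   = refl
  colsₛ : ∀ i l → B i (suc l) ≡ B₁ i (suc l)
  colsₛ zero    zero    = refl
  colsₛ zero    (suc j) = sym (x-x≡0 (border t r N j))
  colsₛ (suc i) l       = refl
  other : ∀ {M} → (∀ i l → M i (suc l) ≡ Bordered₂ t r N i (suc l)) →
          ∀ i l → l ≢ 0F → M i l ≡ Bordered₂ t r N i l
  other M≡ i zero    0≢0 = ⊥-elim (0≢0 refl)
  other M≡ i (suc l) _   = M≡ i l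

det-Bordered₂ : ∀ t r N → det (Bordered₂ t r N) ≡ -2ℤ ^ r * det (Bordered₂ t 0 N)
det-Bordered₂ t zero    N = sym (*-identityˡ _)
det-Bordered₂ t (suc r) N =
  trans (det-Bordered₂-suc t r N)
        (trans (cong (-2ℤ *_) (det-Bordered₂ t r N)) (sym (ℤP.*-assoc -2ℤ (-2ℤ ^ r) (det (Bordered₂ t 0 N)))))

det-Bordered : ∀ t r N → det (Bordered t (suc r) N) ≡ -2ℤ ^ r * (det (Bordered t 1 N) + + r * det (Bordered₂ t 0 N))
det-Bordered t zero N = sym (trans (*-identityˡ _) (trans (cong (λ x → det (Bordered t 1 N) + x) (*-zeroˡ (det (Bordered₂ t 0 N)))) (+-identityʳ _)))
det-Bordered t (suc r) N = begin
  det (Bordered t (suc (suc r)) N)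
    ≡⟨ det-Bordered-suc-suc t r N ⟩
  -2ℤ * (det (Bordered t (suc r) N) + det (Bordered₂ t r N))
    ≡⟨ cong₂ (λ x y → -2ℤ * (x + y)) (det-Bordered t r N) (det-Bordered₂ t r N) ⟩
  -2ℤ * (-2ℤ ^ r * (det (Bordered t 1 N) + + r * det (Bordered₂ t 0 N)) + -2ℤ ^ r * det (Bordered₂ t 0 N))
    ≡⟨ regroup (-2ℤ ^ r) (det (Bordered t 1 N)) (+ r) (det (Bordered₂ t 0 N)) ⟩
  -2ℤ * -2ℤ ^ r * (det (Bordered t 1 N) + (+ 1 + + r) * det (Bordered₂ t 0 N)) ∎
  where
  open ≡-Reasoning
  regroup : ∀ p x k y → -2ℤ * (p * (x + k * y) + p * y) ≡ -2ℤ * p * (x + (+ 1 + k) * y)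
  regroup = solve-∀

border-↑ʳ : ∀ t r N (b : Fin N) → border t r N (r F.↑ʳ b) ≡ ψ t (suc (toℕ b))
border-↑ʳ t zero    N b = refl
border-↑ʳ t (suc r) N b = border-↑ʳ t r N b

border-↑ˡ : ∀ t r N (j : Fin r) → border t r N (j F.↑ˡ N) ≡ + 2
border-↑ˡ t (suc r) N zero    = refl
border-↑ˡ t (suc r) N (suc j) = border-↑ˡ t r N j

Bordered-path-path : ∀ t r N (b b′ : Fin N) → Bordered t r N (r F.↑ʳ b) (r F.↑ʳ b′) ≡ ψ t ∣ toℕ b - toℕ b′ ∣
Bordered-path-path t zero    N b b′ = refl
Bordered-path-path t (suc r) N b b′ = Bordered-path-path t r N b b′

Bordered-hub-path : ∀ t r N (j : Fin r) (b : Fin N) → Bordered t r N (j F.↑ˡ N) (r F.↑ʳ b) ≡ ψ t (suc (toℕ b))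
Bordered-hub-path t (suc r) N zero    b = border-↑ʳ t r N b
Bordered-hub-path t (suc r) N (suc j) b = Bordered-hub-path t r N j b

Bordered-path-hub : ∀ t r N (j : Fin r) (b : Fin N) → Bordered t r N (r F.↑ʳ b) (j F.↑ˡ N) ≡ ψ t (suc (toℕ b))
Bordered-path-hub t (suc r) N zero    b = border-↑ʳ t r N b
Bordered-path-hub t (suc r) N (suc j) b = Bordered-path-hub t r N j b

Bordered-hub-self : ∀ t r N (j : Fin r) → Bordered t r N (j F.↑ˡ N) (j F.↑ˡ N) ≡ + 0
Bordered-hub-self t (suc r) N zero    = refl
Bordered-hub-self t (suc r) N (suc j) = Bordered-hub-self t r N j

Bordered-hub-hub : ∀ t r N (i j : Fin r) → i ≢ j → Bordered t r N (i F.↑ˡ N) (j F.↑ˡ N) ≡ + 2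
Bordered-hub-hub t (suc r) N zero    zero    0≢0 = ⊥-elim (0≢0 refl)
Bordered-hub-hub t (suc r) N zero    (suc j) _   = border-↑ˡ t r N j
Bordered-hub-hub t (suc r) N (suc i) zero    _   = border-↑ˡ t r N i
Bordered-hub-hub t (suc r) N (suc i) (suc j) i≢j = Bordered-hub-hub t r N i j (i≢j ∘ cong suc)

Near : ℤ → ℤ → Set
Near x y = (x ℤ.≤ y + + 1) × (y ℤ.≤ x + + 1)

near-sym : ∀ {x y} → Near x y → Near y x
near-sym (x≤ , y≤) = y≤ , x≤

near-refl : ∀ x → Near x x
near-refl x = ℤP.i≤i+j x (+ 1) , ℤP.i≤i+j x (+ 1)

sign-cases : ∀ d → sign d ≡ + 1 ⊎ sign d ≡ -1ℤ
sign-cases zero          = inj₁ refl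
sign-cases (suc zero)    = inj₂ refl
sign-cases (suc (suc d)) rewrite ℤP.neg-involutive (sign d) = sign-cases d

sign-+ : ∀ c e → sign (c ℕ.+ e) ≡ sign c * sign e
sign-+ zero    e = sym (ℤP.*-identityˡ (sign e))
sign-+ (suc c) e = trans (cong -_ (sign-+ c e)) (ℤP.neg-distribˡ-* (sign c) (sign e))

sign-opposite : ∀ c e → sign c * sign e ≡ -1ℤ → sign c + sign e ≡ + 0
sign-opposite c e product with sign-cases c | sign-cases e
... | inj₁ c≡ | inj₁ e≡ rewrite c≡ | e≡ with product
...   | ()
sign-opposite c e product | inj₁ c≡ | inj₂ e≡ rewrite c≡ | e≡ = refl
sign-opposite c e product | inj₂ c≡ | inj₁ e≡ rewrite c≡ | e≡ = refl
sign-opposite c e product | inj₂ c≡ | inj₂ e≡ rewrite c≡ | e≡ with product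
...   | ()

near-+sign : ∀ x d → Near x (x + sign d)
near-+sign x d with sign-cases d
... | inj₁ eq rewrite eq = ℤP.≤-trans (ℤP.i≤i+j x (+ 1)) (ℤP.i≤i+j (x + + 1) (+ 1)) , ℤP.≤-refl
... | inj₂ eq rewrite eq =
  ℤP.≤-reflexive (sym (cancel x)) , ℤP.+-monoʳ-≤ x ℤ.-≤+
  where cancel : ∀ x → x + -1ℤ + + 1 ≡ x
        cancel = solve-∀

∣-∣-two-steps : ∀ a c → ∣ suc (suc a) - c ∣ ≡ suc (suc ∣ a - c ∣)
                       ⊎ ∣ a - c ∣ ≡ suc (suc ∣ suc (suc a) - c ∣)
                       ⊎ (∣ a - c ∣ ≡ 1 × ∣ suc (suc a) - c ∣ ≡ 1)
∣-∣-two-steps zero    zero                = inj₁ refl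
∣-∣-two-steps zero    (suc zero)          = inj₂ (inj₂ (refl , refl))
∣-∣-two-steps zero    (suc (suc c))       = inj₂ (inj₁ refl)
∣-∣-two-steps (suc a) zero                = inj₁ refl
∣-∣-two-steps (suc a) (suc c)             = ∣-∣-two-steps a c

ψ-near-two-steps : ∀ t a c → Near (ψ t ∣ a - c ∣) (ψ t ∣ suc (suc a) - c ∣)
ψ-near-two-steps t a c with ∣-∣-two-steps a c
... | inj₁ eq                 rewrite eq       = near-+sign (ψ t ∣ a - c ∣) ∣ a - c ∣
... | inj₂ (inj₁ eq)          rewrite eq       = near-sym (near-+sign (ψ t ∣ suc (suc a) - c ∣) ∣ suc (suc a) - c ∣)
... | inj₂ (inj₂ (eq₁ , eq₂)) rewrite eq₁ | eq₂ = near-refl t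

parity : ∀ d → Σ[ a ∈ ℕ ] d ≡ twice a ⊎ Σ[ a ∈ ℕ ] d ≡ suc (twice a)
parity zero          = inj₁ (0 , refl)
parity (suc zero)    = inj₂ (0 , refl)
parity (suc (suc d)) with parity d
... | inj₁ (a , eq) = inj₁ (suc a , cong (λ x → suc (suc x)) eq)
... | inj₂ (a , eq) = inj₂ (suc a , cong (λ x → suc (suc x)) eq)

module OddCycle (k₁ : ℕ) where

  K : ℕ
  K = suc k₁

  t : ℤ
  t = + K

  ψ-twice+1-top : ψ t (suc (twice k₁)) ≡ + 1
  ψ-twice+1-top = trans (ψ-twice+1 t k₁) (regroup (+ k₁))
    where regroup : ∀ k → + 1 + k - k ≡ + 1
          regroup = solve-∀

  ψ-reflect : ∀ c e → c ℕ.+ e ≡ suc (twice k₁) → ψ t c + sign c ≡ ψ t e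
  ψ-reflect zero e refl = sym ψ-twice+1-top
  ψ-reflect (suc zero) e refl = trans (regroup (+ k₁)) (sym (ψ-twice t k₁))
    where regroup : ∀ k → + 1 + k + -1ℤ ≡ k
          regroup = solve-∀
  ψ-reflect (suc (suc c)) e c+e≡ = begin
    ψ t c + sign c + - - sign c          ≡⟨ cong (λ x → x + - - sign c) (ψ-reflect c (suc (suc e)) c+e+2≡) ⟩
    ψ t e + sign e + - - sign c          ≡⟨ cancel (ψ t e) (sign e) (sign c) opposite ⟩
    ψ t e                                ∎
    where
    open ≡-Reasoning
    c+e+2≡ : c ℕ.+ suc (suc e) ≡ suc (twice k₁)
    c+e+2≡ = trans (trans (ℕP.+-suc c (suc e)) (cong suc (ℕP.+-suc c e))) c+e≡
    opposite : sign c + sign e ≡ + 0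
    opposite = sign-opposite c e (begin
      sign c * sign e             ≡⟨ cong (sign c *_) (sym (ℤP.neg-involutive (sign e))) ⟩
      sign c * sign (suc (suc e)) ≡⟨ sym (sign-+ c (suc (suc e))) ⟩
      sign (c ℕ.+ suc (suc e))    ≡⟨ cong sign c+e+2≡ ⟩
      sign (suc (twice k₁))       ≡⟨ cong -_ (sign-twice k₁) ⟩
      -1ℤ                         ∎)
    cancel : ∀ p x y → y + x ≡ + 0 → p + x + - - y ≡ p
    cancel p x y y+x≡0 = trans (regroup p x y) (trans (cong (λ z → p + z) y+x≡0) (+-identityʳ p))
      where regroup : ∀ p x y → p + x + - - y ≡ p + (y + x)
            regroup = solve-∀

  near-reflect : ∀ c e → c ℕ.+ e ≡ suc (twice k₁) → Near (ψ t c) (ψ t ∣ suc (twice k₁) - c ∣)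
  near-reflect c e c+e≡ = subst (Near (ψ t c)) (trans (ψ-reflect c e c+e≡) (cong (ψ t) (sym ∣c+e-c∣≡e)))
                                (near-+sign (ψ t c) c)
    where ∣c+e-c∣≡e : ∣ suc (twice k₁) - c ∣ ≡ e
          ∣c+e-c∣≡e = trans (cong ∣_- c ∣ (sym c+e≡)) (trans (ℕP.∣-∣-comm (c ℕ.+ e) c) (ℕP.∣m-m+n∣≡n c e))

  near-reflect≤ : ∀ c → c ℕ.≤ suc (twice k₁) → Near (ψ t c) (ψ t ∣ suc (twice k₁) - c ∣)
  near-reflect≤ c c≤ = near-reflect c (suc (twice k₁) ∸ c) (ℕP.m+[n∸m]≡n c≤)

  -- The edges of the labelled cycle are (ℓ, ℓ + 2) apart from (2K − 1, 0) and (2K, 1).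
  near-hub-edge : ∀ c → c ℕ.≤ twice K → Near (ψ t c) (ψ t ∣ suc (twice k₁) - c ∣)
  near-hub-edge c c≤ with ℕP.m≤n⇒m<n∨m≡n c≤
  ... | inj₁ (s≤s c≤′) = near-reflect≤ c c≤′
  ... | inj₂ refl      = subst (λ x → Near x (ψ t ∣ suc (twice k₁) - twice K ∣)) (sym (ψ-twice t K))
                               (subst (Near t ∘ ψ t) (sym (∣n-k+n∣≡k (suc (twice k₁)) 1)) (near-refl t))

  near-middle-edge : ∀ c → c ℕ.≤ twice K → Near (ψ t ∣ 1 - c ∣) (ψ t ∣ twice K - c ∣)
  near-middle-edge zero    _       = subst (Near t) (sym (ψ-twice t K)) (near-refl t)
  near-middle-edge (suc c) (s≤s c≤) = near-reflect≤ c c≤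

  ψ-nonneg : ∀ d → d ℕ.≤ twice K → + 0 ℤ.≤ ψ t d
  ψ-nonneg d d≤ with parity d
  ... | inj₁ (a , refl) = subst (+ 0 ℤ.≤_) (sym (ψ-twice t a)) (+≤+ z≤n)
  ... | inj₂ (a , refl) = subst (+ 0 ℤ.≤_) (sym (ψ-twice+1 t a))
                                (ℤP.i≤j⇒0≤j-i (+≤+ (ℕP.≤-trans (twice+1≤twice-suc⇒≤ a k₁ d≤) (ℕP.n≤1+n k₁))))

module _ {n r : ℕ} {m : Fin r → ℕ} where

  adj-sym : ∀ {a b : Vertex n r m} → Adj a b → Adj b a
  adj-sym (inj₁ e) = inj₂ e
  adj-sym (inj₂ e) = inj₁ e

  walk-snoc : ∀ {x y z : Vertex n r m} {ℓ} → Walk x y ℓ → Adj y z → Walk x z (suc ℓ)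
  walk-snoc (stay x)   y~z = step y~z (stay _)
  walk-snoc (step a w) y~z = step a (walk-snoc w y~z)

  walk-reverse : ∀ {x y : Vertex n r m} {ℓ} → Walk x y ℓ → Walk y x ℓ
  walk-reverse (stay x)   = stay x
  walk-reverse (step a w) = walk-snoc (walk-reverse w) (adj-sym a)

  walk-append : ∀ {x y z : Vertex n r m} {ℓ ℓ′} → Walk x y ℓ → Walk y z ℓ′ → Walk x z (ℓ ℕ.+ ℓ′)
  walk-append (stay x)   w′ = w′
  walk-append (step a w) w′ = step a (walk-append w w′)

  walk-length : ∀ {x y : Vertex n r m} {ℓ ℓ′} → ℓ ≡ ℓ′ → Walk x y ℓ → Walk x y ℓ′
  walk-length refl w = w

  walk-length-lower : (f : Vertex n r m → ℤ) → (∀ {a b} → Adj a b → f b ℤ.≤ f a + + 1) →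
                      ∀ {x y ℓ} → Walk x y ℓ → f y ℤ.≤ f x + + ℓ
  walk-length-lower f lip (stay _)   = ℤP.≤-reflexive (sym (+-identityʳ _))
  walk-length-lower f lip {x} (step {ℓ = ℓ} a w) =
    ℤP.≤-trans (walk-length-lower f lip w)
      (ℤP.≤-trans (ℤP.+-monoˡ-≤ (+ ℓ) (lip a)) (ℤP.≤-reflexive (ℤP.+-assoc (f x) (+ 1) (+ ℓ))))

  distance-unique : ∀ {x y : Vertex n r m} {d d′} → IsDistance x y d → IsDistance x y d′ → d ≡ d′
  distance-unique (w , min) (w′ , min′) = ℕP.≤-antisym (min _ w′) (min′ _ w)

-- Distances in C(2K − 1; 1, …, 1)

clamp : (n x : ℕ) → Fin (suc n)
clamp n       zero    = zero
clamp zero    (suc x) = zero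
clamp (suc n) (suc x) = suc (clamp n x)

toℕ-clamp : ∀ n x → x ≤ n → toℕ (clamp n x) ≡ x
toℕ-clamp n       zero    _         = refl
toℕ-clamp (suc n) (suc x) (s≤s x≤n) = cong suc (toℕ-clamp n x x≤n)

clamp-toℕ : ∀ {n} (a : Fin (suc n)) → clamp n (toℕ a) ≡ a
clamp-toℕ         zero    = refl
clamp-toℕ {suc n} (suc a) = cong suc (clamp-toℕ a)

inject₁-clamp : ∀ n x → x ≤ n → inject₁ (clamp n x) ≡ clamp (suc n) x
inject₁-clamp n       zero    _         = refl
inject₁-clamp (suc n) (suc x) (s≤s x≤n) = cong suc (inject₁-clamp n x x≤n)

clamp-self : ∀ n → clamp n n ≡ fromℕ n
clamp-self zero    = refl
clamp-self (suc n) = cong suc (clamp-self n)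

module CycleGraph (k₁ r n : ℕ) (n≡ : n ≡ k₁ ℕ.+ suc k₁) where
  open OddCycle k₁ public

  G : Set
  G = Vertex n r (λ _ → 1)

  -- The cycle v, u₀, …, uₙ of length 2K + 1 is labelled 0, 2, …, 2K, 1, 3, …, 2K − 1.
  pathLabel : ℕ → ℕ
  pathLabel x with x ℕP.<? K
  ... | yes _ = twice (suc x)
  ... | no  _ = suc (twice (x ∸ K))

  pathLabel-< : ∀ x → x < K → pathLabel x ≡ twice (suc x)
  pathLabel-< x x<K with x ℕP.<? K
  ... | yes _   = refl
  ... | no x≮K = ⊥-elim (x≮K x<K)

  pathLabel-≮ : ∀ x → ¬ x < K → pathLabel x ≡ suc (twice (x ∸ K))
  pathLabel-≮ x x≮K with x ℕP.<? K
  ... | yes x<K = ⊥-elim (x≮K x<K)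
  ... | no _    = refl

  pathLabel-+K : ∀ q → pathLabel (q ℕ.+ K) ≡ suc (twice q)
  pathLabel-+K q = trans (pathLabel-≮ (q ℕ.+ K) (ℕP.m+n≮n q K)) (cong (λ x → suc (twice x)) (ℕP.m+n∸n≡m q K))

  label : G → ℕ
  label (u x)   = pathLabel (toℕ x)
  label (v _ _) = 0

  toℕ≤ : ∀ (x : Fin (suc n)) → toℕ x ≤ k₁ ℕ.+ K
  toℕ≤ x = subst (toℕ x ≤_) n≡ (ℕP.≤-pred (FP.toℕ<n x))

  pathLabel≤ : ∀ x → x ≤ k₁ ℕ.+ K → pathLabel x ≤ twice K
  pathLabel≤ x x≤ with x ℕP.<? K
  ... | yes x<K = twice-mono x<K
  ... | no  x≮K = s≤s (ℕP.≤-trans (twice-mono x∸K≤k₁) (ℕP.n≤1+n _))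
    where x∸K≤k₁ : x ∸ K ≤ k₁
          x∸K≤k₁ = ℕP.≤-trans (ℕP.∸-monoˡ-≤ K x≤) (ℕP.≤-reflexive (ℕP.m+n∸n≡m k₁ K))

  label≤ : ∀ x → label x ≤ twice K
  label≤ (u x)   = pathLabel≤ (toℕ x) (toℕ≤ x)
  label≤ (v _ _) = z≤n

  label-fromℕ : label (u (fromℕ n)) ≡ suc (twice k₁)
  label-fromℕ = trans (cong pathLabel (trans (FP.toℕ-fromℕ n) n≡)) (pathLabel-+K k₁)

  hubDist : Fin r → Fin r → ℤ
  hubDist i j with i F.≟ j
  ... | yes _ = + 0
  ... | no  _ = + 2

  distℤ : G → G → ℤ
  distℤ (u a)   y       = ψ t ∣ label (u a) - label y ∣
  distℤ (v i _) (u b)   = ψ t ∣ 0 - label (u b) ∣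
  distℤ (v i _) (v j _) = hubDist i j

  near-two-steps : ∀ c ℓ → Near (ψ t ∣ c - ℓ ∣) (ψ t ∣ c - suc (suc ℓ) ∣)
  near-two-steps c ℓ rewrite ℕP.∣-∣-comm c ℓ | ℕP.∣-∣-comm c (suc (suc ℓ)) = ψ-near-two-steps t ℓ c

  edge-near : ∀ {a b : G} → Edge n r (λ _ → 1) a b → ∀ c → c ≤ twice K →
              Near (ψ t ∣ c - label a ∣) (ψ t ∣ c - label b ∣)
  edge-near (path a) c c≤ with ℕP.<-cmp (suc (toℕ a)) K
  ... | tri< a+1<K _ _
    rewrite FP.toℕ-inject₁ a | pathLabel-< (toℕ a) (ℕP.<-trans (ℕP.n<1+n _) a+1<K) | pathLabel-< (suc (toℕ a)) a+1<K
    = near-two-steps c (twice (suc (toℕ a)))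
  ... | tri≈ _ a+1≡K _
    rewrite FP.toℕ-inject₁ a | ℕP.suc-injective a+1≡K | pathLabel-< k₁ (ℕP.n<1+n k₁) | pathLabel-+K 0
          | ℕP.∣-∣-comm c (twice K) | ℕP.∣-∣-comm c 1
    = near-sym (near-middle-edge c c≤)
  ... | tri> _ _ K<a+1 rewrite FP.toℕ-inject₁ a =
    subst₂ (λ x y → Near (ψ t ∣ c - pathLabel x ∣) (ψ t ∣ c - pathLabel y ∣)) a≡ (cong suc a≡)
      (subst₂ (λ x y → Near (ψ t ∣ c - x ∣) (ψ t ∣ c - y ∣)) (sym (pathLabel-+K q)) (sym (pathLabel-+K (suc q)))
        (near-two-steps c (suc (twice q))))
    where
    q = toℕ a ∸ K
    a≡ : q ℕ.+ K ≡ toℕ a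
    a≡ = ℕP.m∸n+n≡m (ℕP.≤-pred K<a+1)
  edge-near (first j p _) c c≤ rewrite label-fromℕ | ℕP.∣-∣-comm c (suc (twice k₁)) | ℕP.∣-∣-identityʳ c =
    near-sym (near-hub-edge c c≤)
  edge-near (inner j zero zero ())
  edge-near (last j p _) c c≤ = near-two-steps c 0
  edge-near (chord j ())

  hubDist-near-1 : ∀ i j → Near (hubDist i j) (+ 1)
  hubDist-near-1 i j with i F.≟ j
  ... | yes _ = +≤+ z≤n , +≤+ (s≤s z≤n)
  ... | no  _ = +≤+ (s≤s (s≤s z≤n)) , +≤+ (s≤s z≤n)

  distℤ-edge-near : ∀ x {a b : G} → Edge n r (λ _ → 1) a b → Near (distℤ x a) (distℤ x b)
  distℤ-edge-near (u s)   e             = edge-near e (label (u s)) (label≤ (u s))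
  distℤ-edge-near (v i p) (path a)      = edge-near (path a) 0 z≤n
  distℤ-edge-near (v i p) (first j q _) rewrite label-fromℕ | ψ-twice+1-top = near-sym (hubDist-near-1 i j)
  distℤ-edge-near (v i p) (inner j zero zero ())
  distℤ-edge-near (v i p) (last j q _)  = hubDist-near-1 i j
  distℤ-edge-near (v i p) (chord j ())

  distℤ-self : ∀ x → distℤ x x ≡ + 0
  distℤ-self (u a) = cong (ψ t) (ℕP.∣n-n∣≡0 (label (u a)))
  distℤ-self (v i p) with i F.≟ i
  ... | yes _   = refl
  ... | no i≢i = ⊥-elim (i≢i refl)

  distℤ-nonneg : ∀ x y → + 0 ℤ.≤ distℤ x y
  distℤ-nonneg (u a)   y       =
    ψ-nonneg _ (ℕP.≤-trans (ℕP.∣m-n∣≤m⊔n (label (u a)) (label y)) (ℕP.⊔-lub (label≤ (u a)) (label≤ y)))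
  distℤ-nonneg (v i p) (u b)   = ψ-nonneg _ (label≤ (u b))
  distℤ-nonneg (v i p) (v j q) with i F.≟ j
  ... | yes _ = +≤+ z≤n
  ... | no  _ = +≤+ z≤n

  dist : G → G → ℕ
  dist x y = ℤ.∣ distℤ x y ∣

  +dist≡distℤ : ∀ x y → + dist x y ≡ distℤ x y
  +dist≡distℤ x y = ℤP.0≤i⇒+∣i∣≡i (distℤ-nonneg x y)

  dist≤walk : ∀ x y ℓ → Walk x y ℓ → dist x y ≤ ℓ
  dist≤walk x y ℓ w = ℤP.drop‿+≤+ (begin
    + dist x y         ≡⟨ +dist≡distℤ x y ⟩
    distℤ x y          ≤⟨ walk-length-lower (distℤ x) lip w ⟩
    distℤ x x + + ℓ    ≡⟨ cong (_+ + ℓ) (distℤ-self x) ⟩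
    + 0 + + ℓ          ≡⟨ ℤP.+-identityˡ (+ ℓ) ⟩
    + ℓ                ∎)
    where
    open ℤP.≤-Reasoning
    lip : ∀ {a b} → Adj a b → distℤ x b ℤ.≤ distℤ x a + + 1
    lip (inj₁ e) = proj₂ (distℤ-edge-near x e)
    lip (inj₂ e) = proj₁ (distℤ-edge-near x e)

  distℤ-sym : ∀ x y → distℤ x y ≡ distℤ y x
  distℤ-sym (u a)   (u b)   = cong (ψ t) (ℕP.∣-∣-comm (label (u a)) (label (u b)))
  distℤ-sym (u a)   (v j q) = cong (ψ t) (ℕP.∣-∣-comm (label (u a)) 0)
  distℤ-sym (v i p) (u b)   = cong (ψ t) (ℕP.∣-∣-comm 0 (label (u b)))
  distℤ-sym (v i p) (v j q) with i F.≟ j | j F.≟ i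
  ... | yes _   | yes _   = refl
  ... | no  _   | no  _   = refl
  ... | yes i≡j | no  j≢i = ⊥-elim (j≢i (sym i≡j))
  ... | no  i≢j | yes j≡i = ⊥-elim (i≢j (sym j≡i))

  pathLabel-injective : ∀ x y → pathLabel x ≡ pathLabel y → x ≡ y
  pathLabel-injective x y eq = by-cases (x ℕP.<? K) (y ℕP.<? K)
    where
    by-cases : Dec (x < K) → Dec (y < K) → x ≡ y
    by-cases (yes x<K) (yes y<K) =
      ℕP.suc-injective (twice-injective (suc x) (suc y) (trans (sym (pathLabel-< x x<K)) (trans eq (pathLabel-< y y<K))))
    by-cases (yes x<K) (no y≮K) =
      ⊥-elim (twice≢suc-twice (suc x) (y ∸ K) (trans (sym (pathLabel-< x x<K)) (trans eq (pathLabel-≮ y y≮K))))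
    by-cases (no x≮K) (yes y<K) =
      ⊥-elim (twice≢suc-twice (suc y) (x ∸ K) (trans (sym (pathLabel-< y y<K)) (trans (sym eq) (pathLabel-≮ x x≮K))))
    by-cases (no x≮K) (no y≮K) = begin
      x              ≡⟨ sym (ℕP.m∸n+n≡m (ℕP.≮⇒≥ x≮K)) ⟩
      x ∸ K ℕ.+ K    ≡⟨ cong (ℕ._+ K) (twice-injective _ _ (ℕP.suc-injective
                         (trans (sym (pathLabel-≮ x x≮K)) (trans eq (pathLabel-≮ y y≮K))))) ⟩
      y ∸ K ℕ.+ K    ≡⟨ ℕP.m∸n+n≡m (ℕP.≮⇒≥ y≮K) ⟩
      y              ∎
      where open ≡-Reasoning

  pathLabel-positive : ∀ x → 1 ≤ pathLabel x
  pathLabel-positive x with x ℕP.<? K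
  ... | yes _ = s≤s z≤n
  ... | no  _ = s≤s z≤n

  pathIndex : Fin (suc n) → Fin (twice K)
  pathIndex a = F.fromℕ< (pred< (pathLabel-positive (toℕ a)) (pathLabel≤ (toℕ a) (toℕ≤ a)))
    where pred< : ∀ {ℓ N} → 1 ≤ ℓ → ℓ ≤ N → ℕ.pred ℓ < N
          pred< {suc ℓ} _ ℓ<N = ℓ<N

  suc-pathIndex : ∀ a → suc (toℕ (pathIndex a)) ≡ label (u a)
  suc-pathIndex a = trans (cong suc (FP.toℕ-fromℕ< _)) (suc-pred (pathLabel-positive (toℕ a)))
    where suc-pred : ∀ {ℓ} → 1 ≤ ℓ → suc (ℕ.pred ℓ) ≡ ℓ
          suc-pred {suc ℓ} _ = refl

  ↑ˡ≢↑ʳ : ∀ {N} (j : Fin r) (b : Fin N) → j F.↑ˡ N ≢ r F.↑ʳ b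
  ↑ˡ≢↑ʳ {N} j b eq with trans (sym (FP.splitAt-↑ˡ r j N)) (trans (cong (F.splitAt r) eq) (FP.splitAt-↑ʳ r N b))
  ... | ()

  index : G → Fin (r ℕ.+ twice K)
  index (u a)   = r F.↑ʳ pathIndex a
  index (v j _) = j F.↑ˡ twice K

  Bordered-index : ∀ x y → Bordered t r (twice K) (index x) (index y) ≡ distℤ x y
  Bordered-index (u a) (u b) =
    trans (Bordered-path-path t r (twice K) (pathIndex a) (pathIndex b))
          (cong₂ (λ ℓ ℓ′ → ψ t ∣ ℓ - ℓ′ ∣) (suc-pathIndex a) (suc-pathIndex b))
  Bordered-index (u a) (v j _) =
    trans (Bordered-path-hub t r (twice K) j (pathIndex a))
          (cong (ψ t) (trans (suc-pathIndex a) (sym (ℕP.∣-∣-identityʳ (label (u a))))))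
  Bordered-index (v i _) (u b) = trans (Bordered-hub-path t r (twice K) i (pathIndex b)) (cong (ψ t) (suc-pathIndex b))
  Bordered-index (v i _) (v j _) with i F.≟ j
  ... | yes refl = Bordered-hub-self t r (twice K) i
  ... | no  i≢j = Bordered-hub-hub t r (twice K) i j i≢j

  index-injective : ∀ x y → index x ≡ index y → x ≡ y
  index-injective (u a) (u b) eq = cong u (FP.toℕ-injective (pathLabel-injective _ _ (begin
    label (u a)              ≡⟨ sym (suc-pathIndex a) ⟩
    suc (toℕ (pathIndex a))  ≡⟨ cong (λ i → suc (toℕ i)) (FP.↑ʳ-injective r _ _ eq) ⟩
    suc (toℕ (pathIndex b))  ≡⟨ suc-pathIndex b ⟩
    label (u b)              ∎)))
    where open ≡-Reasoning
  index-injective (u a)      (v j zero) eq = ⊥-elim (↑ˡ≢↑ʳ j (pathIndex a) (sym eq))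
  index-injective (v i zero) (u b)      eq = ⊥-elim (↑ˡ≢↑ʳ i (pathIndex b) eq)
  index-injective (v i zero) (v j zero) eq = cong (λ h → v h zero) (FP.↑ˡ-injective (twice K) i j eq)

  -- j₀ only serves to write the path vertices of even label as even j₀ p, which does not depend on the hub.
  module Geodesics (j₀ : Fin r) where

    even : Fin r → ℕ → G
    even j zero    = v j zero
    even j (suc x) = u (clamp n x)

    odd : ℕ → G
    odd q = u (clamp n (q ℕ.+ K))

    k₁≤n : k₁ ≤ n
    k₁≤n = subst (k₁ ≤_) (sym n≡) (ℕP.m≤m+n k₁ K)

    q+K≤n : ∀ q → q ≤ k₁ → q ℕ.+ K ≤ n
    q+K≤n q q≤ = subst (q ℕ.+ K ≤_) (sym n≡) (ℕP.+-monoˡ-≤ K q≤)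

    path-adj : ∀ x → suc x ≤ n → Adj {n} {r} {λ _ → 1} (u (clamp n x)) (u (clamp n (suc x)))
    path-adj x (s≤s x<n) = inj₁ (subst (λ a → Edge n r _ (u a) (u (suc (clamp _ x)))) (inject₁-clamp _ x x<n) (path (clamp _ x)))

    even-adj : ∀ j p → suc p ≤ K → Adj (even j p) (even j (suc p))
    even-adj j zero    _          = inj₁ (last j zero refl)
    even-adj j (suc x) (s≤s x<k₁) = path-adj x (ℕP.≤-trans x<k₁ k₁≤n)

    odd-adj : ∀ q → suc q ≤ k₁ → Adj (odd q) (odd (suc q))
    odd-adj q q<k₁ = path-adj (q ℕ.+ K) (q+K≤n (suc q) q<k₁)

    hub-adj : ∀ j → Adj (even j 0) (odd k₁)
    hub-adj j = inj₂ (subst (λ a → Edge n r _ (u a) (v j zero)) (sym (trans (cong (clamp n) (sym n≡)) (clamp-self n)))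
                            (first j zero refl))

    middle-adj : ∀ j → Adj (even j K) (odd 0)
    middle-adj j = path-adj k₁ (q+K≤n 0 z≤n)

    even-walk : ∀ j d p → d ℕ.+ p ≤ K → Walk (even j p) (even j (d ℕ.+ p)) d
    even-walk j zero    p _  = stay _
    even-walk j (suc d) p d≤ = walk-snoc (even-walk j d p (ℕP.≤-trans (ℕP.n≤1+n _) d≤)) (even-adj j (d ℕ.+ p) d≤)

    odd-walk : ∀ d q → d ℕ.+ q ≤ k₁ → Walk (odd q) (odd (d ℕ.+ q)) d
    odd-walk zero    q _  = stay _
    odd-walk (suc d) q d≤ = walk-snoc (odd-walk d q (ℕP.≤-trans (ℕP.n≤1+n _) d≤)) (odd-adj (d ℕ.+ q) d≤)

    even-walk-to : ∀ j d p p′ → d ℕ.+ p ≡ p′ → p′ ≤ K → Walk (even j p) (even j p′) d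
    even-walk-to j d p p′ refl p′≤ = even-walk j d p p′≤

    odd-walk-to : ∀ d q q′ → d ℕ.+ q ≡ q′ → q′ ≤ k₁ → Walk (odd q) (odd q′) d
    odd-walk-to d q q′ refl q′≤ = odd-walk d q q′≤

    label-even : ∀ j p → p ≤ K → label (even j p) ≡ twice p
    label-even j zero    _        = refl
    label-even j (suc x) (s≤s x≤) = trans (cong pathLabel (toℕ-clamp n x (ℕP.≤-trans x≤ k₁≤n))) (pathLabel-< x (s≤s x≤))

    label-odd : ∀ q → q ≤ k₁ → label (odd q) ≡ suc (twice q)
    label-odd q q≤ = trans (cong pathLabel (toℕ-clamp n (q ℕ.+ K) (q+K≤n q q≤))) (pathLabel-+K q)

    data Position : G → Set where
      at-even : ∀ j p → p ≤ K → Position (even j p)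
      at-odd  : ∀ q → q ≤ k₁ → Position (odd q)

    position : ∀ x → Position x
    position (v j zero) = at-even j zero z≤n
    position (u a) with toℕ a ℕP.<? K
    ... | yes a<K = subst Position (cong u (clamp-toℕ a)) (at-even j₀ (suc (toℕ a)) a<K)
    ... | no  a≮K = subst Position (cong u (trans (cong (clamp n) (ℕP.m∸n+n≡m (ℕP.≮⇒≥ a≮K))) (clamp-toℕ a)))
                          (at-odd (toℕ a ∸ K) (ℕP.≤-trans (ℕP.∸-monoˡ-≤ K (toℕ≤ a)) (ℕP.≤-reflexive (ℕP.m+n∸n≡m k₁ K))))

    Realised : G → G → Set
    Realised x y = Σ[ ℓ ∈ ℕ ] Walk x y ℓ × + ℓ ≡ distℤ x y

    realised-sym : ∀ {x y} → Realised x y → Realised y x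
    realised-sym {x} {y} (ℓ , w , ℓ≡) = ℓ , walk-reverse w , trans ℓ≡ (distℤ-sym x y)

    distℤ-to-path : ∀ x b → distℤ x (u b) ≡ ψ t ∣ label x - label (u b) ∣
    distℤ-to-path (u a)   b = refl
    distℤ-to-path (v i p) b = refl

    length-odd : ∀ ℓ d → ℓ ℕ.+ d ≡ K → + ℓ ≡ ψ t (suc (twice d))
    length-odd ℓ d ℓ+d≡K = begin
      + ℓ                  ≡⟨ cancel (+ ℓ) (+ d) ⟩
      + ℓ + + d - + d      ≡⟨ cong (λ x → x - + d) (trans (sym (ℤP.pos-+ ℓ d)) (cong +_ ℓ+d≡K)) ⟩
      t - + d              ≡⟨ sym (ψ-twice+1 t d) ⟩
      ψ t (suc (twice d))  ∎
      where open ≡-Reasoning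
            cancel : ∀ ℓ d → ℓ ≡ ℓ + d - d
            cancel = solve-∀

    realised-hubs : ∀ i j → Realised (v i zero) (v j zero)
    realised-hubs i j with i F.≟ j
    ... | yes refl = 0 , stay _ , refl
    ... | no  _    = 2 , step (inj₁ (last i zero refl)) (step (inj₂ (last j zero refl)) (stay _)) , refl

    realised-even : ∀ j p x → p ≤ suc x → suc x ≤ K → Realised (even j p) (even j (suc x))
    realised-even j p x p≤ x<K = d , even-walk-to j d p (suc x) d+p≡ x<K , sym (begin
      distℤ (even j p) (even j (suc x))     ≡⟨ distℤ-to-path (even j p) (clamp n x) ⟩
      ψ t ∣ label (even j p) - label (even j (suc x)) ∣
        ≡⟨ cong₂ (λ a b → ψ t ∣ a - b ∣) (label-even j p (ℕP.≤-trans p≤ x<K)) (label-even j (suc x) x<K) ⟩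
      ψ t ∣ twice p - twice (suc x) ∣       ≡⟨ cong (λ y → ψ t ∣ twice p - twice y ∣) (sym d+p≡) ⟩
      ψ t ∣ twice p - twice (d ℕ.+ p) ∣     ≡⟨ cong (ψ t) (∣twice-twice∣ p d) ⟩
      ψ t (twice d)                         ≡⟨ ψ-twice t d ⟩
      + d                                   ∎)
      where
      open ≡-Reasoning
      d = suc x ∸ p
      d+p≡ : d ℕ.+ p ≡ suc x
      d+p≡ = ℕP.m∸n+n≡m p≤

    realised-odd : ∀ q q′ → q ≤ q′ → q′ ≤ k₁ → Realised (odd q) (odd q′)
    realised-odd q q′ q≤ q′≤ = d , odd-walk-to d q q′ d+q≡ q′≤ , sym (begin
      ψ t ∣ label (odd q) - label (odd q′) ∣
        ≡⟨ cong₂ (λ a b → ψ t ∣ a - b ∣) (label-odd q (ℕP.≤-trans q≤ q′≤)) (label-odd q′ q′≤) ⟩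
      ψ t ∣ twice q - twice q′ ∣            ≡⟨ cong (λ y → ψ t ∣ twice q - twice y ∣) (sym d+q≡) ⟩
      ψ t ∣ twice q - twice (d ℕ.+ q) ∣     ≡⟨ cong (ψ t) (∣twice-twice∣ q d) ⟩
      ψ t (twice d)                         ≡⟨ ψ-twice t d ⟩
      + d                                   ∎)
      where
      open ≡-Reasoning
      d = q′ ∸ q
      d+q≡ : d ℕ.+ q ≡ q′
      d+q≡ = ℕP.m∸n+n≡m q≤

    -- even vertex p and odd vertex d + p: the geodesic runs through the hub j
    realised-around : ∀ j p d → d ℕ.+ p ≤ k₁ → Realised (even j p) (odd (d ℕ.+ p))
    realised-around j p d q≤ =
      p ℕ.+ suc e ,
      walk-append (walk-reverse (even-walk-to j p 0 p (ℕP.+-identityʳ p) p≤K))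
                  (step (hub-adj j) (walk-reverse (odd-walk-to e (d ℕ.+ p) k₁ e+q≡ ℕP.≤-refl))) ,
      trans (length-odd (p ℕ.+ suc e) d (trans (rearrange p e d) (cong suc e+q≡)))
            (sym (trans (distℤ-to-path (even j p) (clamp n (d ℕ.+ p ℕ.+ K)))
                        (cong (ψ t) (trans (cong₂ ∣_-_∣ (label-even j p p≤K) (label-odd (d ℕ.+ p) q≤))
                                           (∣twice-twice+1∣ p d)))))
      where
      p≤K : p ≤ K
      p≤K = ℕP.≤-trans (ℕP.m≤n+m p d) (ℕP.≤-trans q≤ (ℕP.n≤1+n k₁))
      e = k₁ ∸ (d ℕ.+ p)
      e+q≡ : e ℕ.+ (d ℕ.+ p) ≡ k₁
      e+q≡ = ℕP.m∸n+n≡m q≤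
      rearrange : ∀ p e d → p ℕ.+ suc e ℕ.+ d ≡ suc (e ℕ.+ (d ℕ.+ p))
      rearrange = ℕS.solve-∀

    -- even vertex suc (d + q) and odd vertex q: the geodesic crosses the middle edge u_{K−1} u_K
    realised-middle : ∀ j q d → suc (d ℕ.+ q) ≤ K → q ≤ k₁ → Realised (even j (suc (d ℕ.+ q))) (odd q)
    realised-middle j q d p≤K q≤ =
      e ℕ.+ suc q ,
      walk-append (even-walk-to j e (suc (d ℕ.+ q)) K e+p≡ ℕP.≤-refl)
                  (step (middle-adj j) (odd-walk-to q 0 q (ℕP.+-identityʳ q) q≤)) ,
      trans (length-odd (e ℕ.+ suc q) d (trans (rearrange e q d) e+p≡))
            (sym (cong (ψ t) (trans (cong₂ ∣_-_∣ (label-even j (suc (d ℕ.+ q)) p≤K) (label-odd q q≤))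
                                    (∣twice-suc-twice+1∣ q d))))
      where
      e = K ∸ suc (d ℕ.+ q)
      e+p≡ : e ℕ.+ suc (d ℕ.+ q) ≡ K
      e+p≡ = ℕP.m∸n+n≡m p≤K
      rearrange : ∀ e q d → e ℕ.+ suc q ℕ.+ d ≡ e ℕ.+ suc (d ℕ.+ q)
      rearrange = ℕS.solve-∀

    realised-even-odd : ∀ j p q → p ≤ K → q ≤ k₁ → Realised (even j p) (odd q)
    realised-even-odd j p q p≤K q≤ with p ℕP.≤? q
    ... | yes p≤q = subst (Realised (even j p) ∘ odd) d+p≡ (realised-around j p (q ∸ p) (subst (_≤ k₁) (sym d+p≡) q≤))
      where d+p≡ : q ∸ p ℕ.+ p ≡ q
            d+p≡ = ℕP.m∸n+n≡m p≤q
    ... | no  p≰q = subst (λ p′ → Realised (even j p′) (odd q)) d+q≡ (realised-middle j q (p ∸ suc q) (subst (_≤ K) (sym d+q≡) p≤K) q≤)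
      where d+q≡ : suc (p ∸ suc q ℕ.+ q) ≡ p
            d+q≡ = trans (sym (ℕP.+-suc (p ∸ suc q) q)) (ℕP.m∸n+n≡m (ℕP.≰⇒> p≰q))

    realised-positions : ∀ {x y} → Position x → Position y → Realised x y
    realised-positions (at-even i zero _)     (at-even j zero _)     = realised-hubs i j
    realised-positions (at-even i zero _)     (at-even j (suc y) y<) = realised-even i 0 y z≤n y<
    realised-positions (at-even i (suc x) x<) (at-even j zero _)     = realised-sym (realised-even j 0 x z≤n x<)
    realised-positions (at-even i (suc x) x<) (at-even j (suc y) y<) with suc x ℕP.≤? suc y
    ... | yes x≤y = realised-even i (suc x) y x≤y y<
    ... | no  x≰y = realised-sym (realised-even j (suc y) x (ℕP.<⇒≤ (ℕP.≰⇒> x≰y)) x<)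
    realised-positions (at-odd p p≤)         (at-odd q q≤) with p ℕP.≤? q
    ... | yes p≤q = realised-odd p q p≤q q≤
    ... | no  p≰q = realised-sym (realised-odd q p (ℕP.<⇒≤ (ℕP.≰⇒> p≰q)) p≤)
    realised-positions (at-even i p p≤)      (at-odd q q≤)          = realised-even-odd i p q p≤ q≤
    realised-positions (at-odd q q≤)         (at-even j p p≤)       = realised-sym (realised-even-odd j p q p≤ q≤)

    isDistance : ∀ x y → IsDistance x y (dist x y)
    isDistance x y with realised-positions (position x) (position y)
    ... | ℓ , w , ℓ≡ = walk-length (cong ℤ.∣_∣ ℓ≡) w , dist≤walk x y

module _ (k₁ r n : ℕ) (n≡ : n ≡ k₁ ℕ.+ suc k₁) (j₀ : Fin r) {M : ℕ}
         (e : Fin M ↔ Vertex n r (λ _ → 1)) (M≡ : M ≡ r ℕ.+ twice (suc k₁))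
         (D : Fin M → Fin M → ℕ) (D-dist : ∀ i j → IsDistance (Inverse.to e i) (Inverse.to e j) (D i j)) where
  open CycleGraph k₁ r n n≡
  open Geodesics j₀

  private
    to = Inverse.to e
    B : Matrix M
    B a b = Bordered t r (twice K) (cast M≡ a) (cast M≡ b)
    σ : Fin M → Fin M
    σ a = cast (sym M≡) (index (to a))
    cast-σ : ∀ a → cast M≡ (σ a) ≡ index (to a)
    cast-σ a = FP.cast-involutive M≡ (sym M≡) (index (to a))
    σ-injective : ∀ a b → σ a ≡ σ b → a ≡ b
    σ-injective a b eq = begin
      a                       ≡⟨ sym (Inverse.strictlyInverseʳ e a) ⟩
      Inverse.from e (to a)   ≡⟨ cong (Inverse.from e) (index-injective (to a) (to b)
                                   (trans (sym (cast-σ a)) (trans (cong (cast M≡) eq) (cast-σ b)))) ⟩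
      Inverse.from e (to b)   ≡⟨ Inverse.strictlyInverseʳ e b ⟩
      b                       ∎
      where open ≡-Reasoning
    entry : ∀ a b → + D a b ≡ B (σ a) (σ b)
    entry a b = begin
      + D a b                                       ≡⟨ cong +_ (distance-unique (D-dist a b) (isDistance (to a) (to b))) ⟩
      + dist (to a) (to b)                          ≡⟨ +dist≡distℤ (to a) (to b) ⟩
      distℤ (to a) (to b)                           ≡⟨ sym (Bordered-index (to a) (to b)) ⟩
      Bordered t r (twice K) (index (to a)) (index (to b)) ≡⟨ sym (cong₂ (Bordered t r (twice K)) (cast-σ a) (cast-σ b)) ⟩
      B (σ a) (σ b)                                 ∎
      where open ≡-Reasoning

  det-distanceMatrix : det (λ a b → + D a b) ≡ det (Bordered t r (twice K))
  det-distanceMatrix = begin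
    det (λ a b → + D a b)            ≡⟨ det-cong entry ⟩
    det (λ a b → B (σ a) (σ b))      ≡⟨ det-conj-injective σ σ-injective B ⟩
    det B                            ≡⟨ det-cast M≡ (Bordered t r (twice K)) ⟩
    det (Bordered t r (twice K))     ∎
    where open ≡-Reasoning

3k²-k-2 : ∀ j → let k = 2 ℕ.+ j in
  + (3 ℕ.* k ℕ.* k ∸ k ∸ 2) ≡ + 3 * (+ 2 + + j) * (+ 2 + + j) - (+ 2 + + j) - + 2
3k²-k-2 j = begin
  + (3 ℕ.* k ℕ.* k ∸ k ∸ 2)           ≡⟨ cong (λ x → + (x ∸ k ∸ 2)) 3kk≡ ⟩
  + (Q ℕ.+ 2 ℕ.+ k ∸ k ∸ 2)           ≡⟨ cong (λ x → + (x ∸ 2)) (ℕP.m+n∸n≡m (Q ℕ.+ 2) k) ⟩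
  + (Q ℕ.+ 2 ∸ 2)                     ≡⟨ cong +_ (ℕP.m+n∸n≡m Q 2) ⟩
  + Q                                 ≡⟨ cancel (+ Q) (+ k) ⟩
  + Q + + 2 + + k - + k - + 2         ≡⟨ cong (λ x → x - + k - + 2) (sym (trans (cong +_ 3kk≡) (ℤP.pos-+ (Q ℕ.+ 2) k))) ⟩
  + (3 ℕ.* k ℕ.* k) - + k - + 2       ≡⟨ cong (λ x → x - + k - + 2) (trans (ℤP.pos-* (3 ℕ.* k) k) (cong (_* + k) (ℤP.pos-* 3 k))) ⟩
  + 3 * + k * + k - + k - + 2         ∎
  where
  open ≡-Reasoning
  k = 2 ℕ.+ j
  Q = 3 ℕ.* j ℕ.* j ℕ.+ 11 ℕ.* j ℕ.+ 8
  3kk≡ : 3 ℕ.* k ℕ.* k ≡ Q ℕ.+ 2 ℕ.+ k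
  3kk≡ = expand j
    where expand : ∀ j → 3 ℕ.* (2 ℕ.+ j) ℕ.* (2 ℕ.+ j) ≡ 3 ℕ.* j ℕ.* j ℕ.+ 11 ℕ.* j ℕ.+ 8 ℕ.+ 2 ℕ.+ (2 ℕ.+ j)
          expand = ℕS.solve-∀
  cancel : ∀ q k → q ≡ q + + 2 + k - k - + 2
  cancel = solve-∀

mainTheorem9 :
  (r k : ℕ) → 2 ≤ r → 2 ≤ k →
  (e : Fin (2 ℕ.* k ℕ.+ r) ↔ Vertex (2 ℕ.* k ∸ 1) r (λ _ → 1)) →
  (D : Fin (2 ℕ.* k ℕ.+ r) → Fin (2 ℕ.* k ℕ.+ r) → ℕ) →
  (∀ i j → IsDistance (Inverse.to e i) (Inverse.to e j) (D i j)) →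
  det (λ i j → + D i j)
    ≡ (-[1+ 1 ] ℤ.^ (r ∸ 1))
      ℤ.* ((+ k) ℤ.* (+ (k ℕ.+ 1))
           ℤ.- (+ (r ∸ 1)) ℤ.* (+ (3 ℕ.* k ℕ.* k ∸ k ∸ 2)))
mainTheorem9 (suc r′) (suc (suc j)) (s≤s (s≤s _)) (s≤s (s≤s _)) e D D-dist = begin
  det (λ a b → + D a b)
    ≡⟨ det-distanceMatrix (suc j) (suc r′) n n≡ zero e M≡ D D-dist ⟩
  det (Bordered t (suc r′) (twice k))
    ≡⟨ det-Bordered t r′ (twice k) ⟩
  -2ℤ ^ r′ * (det (Bordered t 1 (twice k)) + + r′ * det (Bordered₂ t 0 (twice k)))
    ≡⟨ cong₂ (λ x y → -2ℤ ^ r′ * (x + + r′ * y)) (trans (det-Bordered₁ t (twice k)) (det-Ψ-odd (suc j)))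
             (trans (det-Bordered₂-zero t (twice k)) (cong₂ (λ x y → x + + 2 * y) (det-Ψ-odd (suc j)) (det-Ψ-even j))) ⟩
  -2ℤ ^ r′ * (t * (+ 1 + t) + + r′ * (t * (+ 1 + t) + + 2 * (+ 1 - + 2 * (t * t))))
    ≡⟨ collect (-2ℤ ^ r′) (+ r′) (+ j) ⟩
  -2ℤ ^ r′ * (t * (+ 1 + t) - + r′ * (+ 3 * t * t - t - + 2))
    ≡⟨ cong₂ (λ x y → -2ℤ ^ r′ * (t * x - + r′ * y)) (cong +_ (ℕP.+-comm 1 k)) (sym (3k²-k-2 j)) ⟩
  -2ℤ ^ r′ * (t * + (k ℕ.+ 1) - + r′ * + (3 ℕ.* k ℕ.* k ∸ k ∸ 2)) ∎
  where
  open ≡-Reasoning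
  k = suc (suc j)
  t = + k
  n = 2 ℕ.* k ∸ 1
  n≡ : n ≡ suc j ℕ.+ suc (suc j)
  n≡ = cong (λ x → suc (j ℕ.+ x)) (ℕP.+-identityʳ k)
  M≡ : 2 ℕ.* k ℕ.+ suc r′ ≡ suc r′ ℕ.+ twice k
  M≡ = trans (ℕP.+-comm (2 ℕ.* k) (suc r′)) (cong (suc r′ ℕ.+_) (sym (twice≡2* k)))
  collect : ∀ p r j → let t = + 2 + j in
    p * (t * (+ 1 + t) + r * (t * (+ 1 + t) + + 2 * (+ 1 - + 2 * (t * t))))
      ≡ p * (t * (+ 1 + t) - r * (+ 3 * t * t - t - + 2))
  collect = solve-∀
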